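{- Let $Q$ be a connected quiver of rank $3$ with at least one frozen vertex whose mutable part $Q^{\mathrm{mut}}$ is mutation-abundant, and let $\mathbf M=m_1m_2\cdots$ be a reduced, weakly balanced mutation sequence which is cycle-preserving for $Q^{\mathrm{mut}}$. Then $Q$ is eventually sign-coherent on $\mathbf M$: there is $T$ with $Q^{(j)}_{\mathbf M}$ sign-coherent for all $j>T$.
   Context: A quiver is a finite directed graph without loops or oriented 2-cycles, vertices partitioned into mutable and frozen; arrows between frozen vertices are ignored. $b_{ij}$ = #arrows $i\to j$ − #arrows $j\to i$. Mutation $\mu_j$ at mutable $j$: for each path $i\xrightarrow{a}j\xrightarrow{b}k$ add $ab$ arrows $i\to k$, reverse arrows at $j$, cancel oriented 2-cycles. $Q^{(0)}_{\mathbf M}=Q$, $Q^{(i)}_{\mathbf M}=\mu_{m_i}(Q^{(i-1)}_{\mathbf M})$. Reduced: $m_i\ne m_{i+1}$; weakly balanced: every mutable vertex occurs infinitely often. A quiver is connected if its mutable part is connected as an undirected graph and there are no isolated frozen vertices. A quiver (here without frozen vertices) is mutation-abundant if in every quiver mutation-equivalent to it, $|b_{ij}|\ge2$ for all distinct $i,j$. A 3-vertex quiver is an oriented cycle if it has at most one frozen vertex and its underlying directed graph is not acyclic. A mutation at $j$ is cycle-preserving for a quiver $P$ if whenever $P|_{ijk}$ is an oriented 3-cycle containing $j$, so is $\mu_j(P)|_{ijk}$. $\mathbf M$ is cycle-preserving for $Q^{\mathrm{mut}}$ if $m_\ell$ is cycle-preserving for $(Q^{(\ell-1)}_{\mathbf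 M})^{\mathrm{mut}}$ for all $\ell\ge1$. Red/green: a mutable vertex adjacent to a frozen vertex is red (green) if all its arrows to frozen vertices point toward (away from) it; a quiver is sign-coherent if every mutable vertex is red or green. -}

module Defs where

open import Data.Nat using (ℕ; zero; suc; _≥_)
open import Data.Integer using (ℤ; 0ℤ; +_; -_; _+_; _-_; _*_; _⊔_; _≤_; _<_; ∣_∣)
open import Data.Fin using (Fin; _≟_)
open import Data.List using (List; []; _∷_)
open import Data.Product using (_×_; ∃; Σ)
open import Data.Sum using (_⊎_)
open import Relation.Nullary using (¬_; Dec; yes; no)
open import Relation.Binary.PropositionalEquality using (_≡_; _≢_)

-- A quiver is encoded by its (extended) exchange data:
--   B i j = b_ij for mutable i j (#arrows i→j − #arrows j→i),
--   C a i = b_ai for frozen a and mutable i (#arrows a→i − #arrows i→a).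
-- Arrows between frozen vertices are ignored, so they are not recorded.
-- (No loops / no oriented 2-cycles: a quiver is determined by these numbers.)
record Quiver (f : ℕ) : Set where
  constructor quiver
  field
    B : Fin 3 → Fin 3 → ℤ
    C : Fin f → Fin 3 → ℤ
open Quiver public

SkewSym : (Fin 3 → Fin 3 → ℤ) → Set
SkewSym B = ∀ i j → B i j ≡ - B j i

pos : ℤ → ℤ
pos x = x ⊔ 0ℤ

-- Quiver mutation at j on the mutable part (paths i→j→k add arrows i→k,
-- arrows at j reversed, 2-cycles cancelled).
mutB : Fin 3 → (Fin 3 → Fin 3 → ℤ) → Fin 3 → Fin 3 → ℤ
mutB j B i k with i ≟ j | k ≟ j
... | yes _ | _     = - B i k
... | no _  | yes _ = - B i k
... | no _  | no _  = B i k + pos (B i j) * pos (B j k) - pos (- B i j) * pos (- B j k)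

mutC : ∀ {f} → Fin 3 → (Fin 3 → Fin 3 → ℤ) → (Fin f → Fin 3 → ℤ) → Fin f → Fin 3 → ℤ
mutC j B C a k with k ≟ j
... | yes _ = - C a k
... | no _  = C a k + pos (C a j) * pos (B j k) - pos (- C a j) * pos (- B j k)

μ : ∀ {f} → Fin 3 → Quiver f → Quiver f
μ j Q = quiver (mutB j (B Q)) (mutC j (B Q) (C Q))

mutBs : List (Fin 3) → (Fin 3 → Fin 3 → ℤ) → Fin 3 → Fin 3 → ℤ
mutBs []       B = B
mutBs (j ∷ js) B = mutBs js (mutB j B)

MutationAbundant : (Fin 3 → Fin 3 → ℤ) → Set
MutationAbundant B = ∀ (js : List (Fin 3)) (i j : Fin 3) → i ≢ j → ∣ mutBs js B i j ∣ ≥ 2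

data Reach (B : Fin 3 → Fin 3 → ℤ) : Fin 3 → Fin 3 → Set where
  here : ∀ {i} → Reach B i i
  step : ∀ {i j k} → B i j ≢ 0ℤ → Reach B j k → Reach B i k

Connected : ∀ {f} → Quiver f → Set
Connected {f} Q = (∀ i j → Reach (B Q) i j) × (∀ (a : Fin f) → ∃ λ i → C Q a i ≢ 0ℤ)

-- Q^{(0)} = Q, Q^{(ℓ+1)} = μ_{m_{ℓ+1}} Q^{(ℓ)}, where m_{ℓ+1} = M ℓ.
Qseq : ∀ {f} → Quiver f → (ℕ → Fin 3) → ℕ → Quiver f
Qseq Q M zero    = Q
Qseq Q M (suc ℓ) = μ (M ℓ) (Qseq Q M ℓ)

Reduced : (ℕ → Fin 3) → Set
Reduced M = ∀ ℓ → M ℓ ≢ M (suc ℓ)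

WeaklyBalanced : (ℕ → Fin 3) → Set
WeaklyBalanced M = ∀ (v : Fin 3) (N : ℕ) → ∃ λ n → n ≥ N × M n ≡ v

Cyclic3 : (Fin 3 → Fin 3 → ℤ) → Fin 3 → Fin 3 → Fin 3 → Set
Cyclic3 B i j k =
  (0ℤ < B i j × 0ℤ < B j k × 0ℤ < B k i) ⊎ (B i j < 0ℤ × B j k < 0ℤ × B k i < 0ℤ)

CyclePreservingAt : Fin 3 → (Fin 3 → Fin 3 → ℤ) → Set
CyclePreservingAt j B = ∀ i k → i ≢ j → k ≢ j → i ≢ k →
  Cyclic3 B i j k → Cyclic3 (mutB j B) i j k

-- M cycle-preserving for Q^mut: m_ℓ cycle-preserving for (Q^{(ℓ-1)})^mut, ℓ ≥ 1.
CyclePreserving : (ℕ → Fin 3) → (Fin 3 → Fin 3 → ℤ) → Set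
CyclePreserving M B = ∀ ℓ → CyclePreservingAt (M ℓ) (mutBs' ℓ)
  where
    mutBs' : ℕ → Fin 3 → Fin 3 → ℤ
    mutBs' zero    = B
    mutBs' (suc ℓ) = mutB (M ℓ) (mutBs' ℓ)

Red : ∀ {f} → Quiver f → Fin 3 → Set
Red {f} Q i = (∃ λ (a : Fin f) → C Q a i ≢ 0ℤ) × (∀ a → 0ℤ ≤ C Q a i)

Green : ∀ {f} → Quiver f → Fin 3 → Set
Green {f} Q i = (∃ λ (a : Fin f) → C Q a i ≢ 0ℤ) × (∀ a → C Q a i ≤ 0ℤ)

SignCoherent : ∀ {f} → Quiver f → Set
SignCoherent Q = ∀ i → Red Q i ⊎ Green Q i

-- Abundance keeps |b_ij| ≥ 2 along the sequence, so every mutable part is an oriented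
-- 3-cycle or acyclic. Mutating an acyclic quiver at its source gives an acyclic quiver with
-- that vertex as sink, mutating it at its middle vertex gives a cycle, and cycle-preservation
-- keeps a cycle a cycle. Reversing all arrows commutes with mutation, so we may assume that
-- the first mutation is not at a sink; as M is reduced, every later acyclic quiver then has
-- the last mutated vertex as its sink and is next mutated at its source or middle vertex.
--
-- Read the row of a frozen vertex in the frame of the current quiver. In the acyclic regime
-- the potential a − [−b]₊ − [−c]₊ never decreases and grows within any three mutations; in
-- the cyclic regime min(p − [−m]₊, −s − [m]₊) never decreases and grows across every window
-- succ · pred^k · succ of moves, and such windows recur because M is weakly balanced. Growth
-- can only fail on a zero row, which connectedness excludes. Once a potential is positive an
-- invariant holds forever (in an intermediate form right after the quiver turns cyclic); it
-- fixes the sign of every entry except at the last mutated vertex, whose entries were just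
-- negated and so have the opposite of their previous, already fixed, signs.

module Submission where

open import Defs
open import Data.Nat using (ℕ; suc; _≥_; _>_)
open import Data.Fin using (Fin)
open import Data.Product using (∃)
open import Data.Nat as ℕ using (zero; z≤n; s≤s; _∸_)
import Data.Nat.Properties as ℕP
open import Data.Fin as Fin using (_≟_)
open import Data.Fin.Properties using (all?)
open import Data.Integer as ℤ using (ℤ; +_; -[1+_]; 0ℤ; 1ℤ; -1ℤ; _+_; _-_; _*_; -_; _≤_; _<_; _⊓_; ∣_∣)
import Data.Integer.Properties as ℤP
open import Data.Integer.Tactic.RingSolver using (solve-∀)
open import Data.List using ([]; _∷_)
open import Data.Product using (_×_; _,_; proj₁; proj₂; Σ; ∃₂)
open import Data.Sum using (_⊎_; inj₁; inj₂; [_,_]′)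
open import Data.Empty using (⊥; ⊥-elim)
open import Relation.Nullary using (¬_; ¬?; Dec; yes; no)
open import Relation.Nullary.Decidable using (from-yes; _→-dec_; _⊎-dec_)
open import Relation.Binary.PropositionalEquality
open import Function using (_∘_)

2ℤ -2ℤ : ℤ
2ℤ = + 2
-2ℤ = - 2ℤ

≤-slack : ∀ {a b} d → b ≡ a + d → 0ℤ ≤ d → a ≤ b
≤-slack {a} d refl 0≤d = ℤP.i≤i+j a d {{ℤ.nonNegative 0≤d}}

≤-+-nonneg : ∀ a {d} → 0ℤ ≤ d → a ≤ a + d
≤-+-nonneg a {d} 0≤d = ℤP.i≤i+j a d {{ℤ.nonNegative 0≤d}}

+-nonneg : ∀ {a b} → 0ℤ ≤ a → 0ℤ ≤ b → 0ℤ ≤ a + b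
+-nonneg = ℤP.+-mono-≤

*-nonneg : ∀ {a b} → 0ℤ ≤ a → 0ℤ ≤ b → 0ℤ ≤ a * b
*-nonneg {+ m} {+ n} _ _ = subst (0ℤ ≤_) (ℤP.pos-* m n) (ℤ.+≤+ z≤n)

1≤⇒0≤ : ∀ {x} → 1ℤ ≤ x → 0ℤ ≤ x
1≤⇒0≤ = ℤP.≤-trans (ℤ.+≤+ z≤n)

2≤⇒0≤ : ∀ {x} → 2ℤ ≤ x → 0ℤ ≤ x
2≤⇒0≤ = ℤP.≤-trans (ℤ.+≤+ z≤n)

≤-1⇒≤0 : ∀ {x} → x ≤ -1ℤ → x ≤ 0ℤ
≤-1⇒≤0 x≤-1 = ℤP.≤-trans x≤-1 ℤ.-≤+

≤-2⇒≤0 : ∀ {x} → x ≤ -2ℤ → x ≤ 0ℤ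
≤-2⇒≤0 x≤-2 = ℤP.≤-trans x≤-2 ℤ.-≤+

1≤⇒≢0 : ∀ {x} → 1ℤ ≤ x → x ≢ 0ℤ
1≤⇒≢0 1≤x x≡0 = ℤP.<⇒≢ (ℤP.suc[i]≤j⇒i<j 1≤x) (sym x≡0)

≤-1⇒≢0 : ∀ {x} → x ≤ -1ℤ → x ≢ 0ℤ
≤-1⇒≢0 x≤-1 = ℤP.<⇒≢ (ℤP.≤-<-trans x≤-1 ℤ.-<+)

nonneg-sum≡0 : ∀ {a b} → 0ℤ ≤ a → 0ℤ ≤ b → a + b ≡ 0ℤ → a ≡ 0ℤ × b ≡ 0ℤ
nonneg-sum≡0 {a} {b} 0≤a 0≤b eq =
  ℤP.≤-antisym (subst (a ≤_) eq (≤-+-nonneg a 0≤b)) 0≤a ,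
  ℤP.≤-antisym (subst (b ≤_) (trans (ℤP.+-comm b a) eq) (≤-+-nonneg b 0≤a)) 0≤b

pos-nonneg : ∀ x → 0ℤ ≤ pos x
pos-nonneg x = ℤP.i≤j⊔i x 0ℤ

pos-of-nonneg : ∀ {x} → 0ℤ ≤ x → pos x ≡ x
pos-of-nonneg = ℤP.i≥j⇒i⊔j≡i

pos-of-nonpos : ∀ {x} → x ≤ 0ℤ → pos x ≡ 0ℤ
pos-of-nonpos = ℤP.i≤j⇒i⊔j≡j

pos-mono : ∀ {x y} → x ≤ y → pos x ≤ pos y
pos-mono = ℤP.⊔-monoˡ-≤ 0ℤ

pos≡0⇒≤0 : ∀ {x} → pos x ≡ 0ℤ → x ≤ 0ℤ
pos≡0⇒≤0 {x} eq = subst (x ≤_) eq (ℤP.i≤i⊔j x 0ℤ)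

-- The ring solver treats x, [x]₊ and [−x]₊ as unrelated atoms, so identities that need
-- x = [x]₊ − [−x]₊ are proved up to a multiple of `gap x`, which vanishes.
gap : ℤ → ℤ
gap x = x - (pos x - pos (- x))

gap≡0 : ∀ x → gap x ≡ 0ℤ
gap≡0 x with ℤP.≤-total x 0ℤ
... | inj₁ x≤0 rewrite pos-of-nonpos x≤0 | pos-of-nonneg (ℤP.neg-mono-≤ x≤0) = lemma x
  where lemma : ∀ x → x - (0ℤ - - x) ≡ 0ℤ
        lemma = solve-∀
... | inj₂ 0≤x rewrite pos-of-nonneg 0≤x | pos-of-nonpos (ℤP.neg-mono-≤ 0≤x) = lemma x
  where lemma : ∀ x → x - (x - 0ℤ) ≡ 0ℤ
        lemma = solve-∀

≤-slack-gap : ∀ {a b} d x → b ≡ a + d + gap x → 0ℤ ≤ d → a ≤ b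
≤-slack-gap {a} d x eq =
  ≤-slack d (trans eq (trans (cong (λ g → a + d + g) (gap≡0 x)) (ℤP.+-identityʳ (a + d))))

≤-slack-gaps : ∀ {a b} d x y → b ≡ a + d + (gap x - gap y) → 0ℤ ≤ d → a ≤ b
≤-slack-gaps {a} d x y eq =
  ≤-slack d (trans eq (trans (cong₂ (λ g h → a + d + (g - h)) (gap≡0 x) (gap≡0 y)) (ℤP.+-identityʳ (a + d))))

mutEntry : ℤ → ℤ → ℤ → ℤ
mutEntry bij bjk bik = bik + pos bij * pos bjk - pos (- bij) * pos (- bjk)

mutEntry-nonneg : ∀ x {b} y → 0ℤ ≤ b → mutEntry x b y ≡ y + pos x * b
mutEntry-nonneg x {b} y 0≤b rewrite pos-of-nonneg 0≤b | pos-of-nonpos (ℤP.neg-mono-≤ 0≤b) =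
  lemma y (pos x) b (pos (- x))
  where lemma : ∀ y u b v → y + u * b - v * 0ℤ ≡ y + u * b
        lemma = solve-∀

mutEntry-nonpos : ∀ x {b} y → b ≤ 0ℤ → mutEntry x b y ≡ y - pos (- x) * (- b)
mutEntry-nonpos x {b} y b≤0 rewrite pos-of-nonpos b≤0 | pos-of-nonneg (ℤP.neg-mono-≤ b≤0) =
  lemma y (pos x) (- b) (pos (- x))
  where lemma : ∀ y u b v → y + u * 0ℤ - v * b ≡ y - v * b
        lemma = solve-∀

mutEntry-pos-pos : ∀ {x b} y → 0ℤ ≤ x → 0ℤ ≤ b → mutEntry x b y ≡ y + x * b
mutEntry-pos-pos {x} y 0≤x 0≤b =
  trans (mutEntry-nonneg x y 0≤b) (cong (λ u → y + u * _) (pos-of-nonneg 0≤x))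

mutEntry-pos-neg : ∀ {x b} y → 0ℤ ≤ x → b ≤ 0ℤ → mutEntry x b y ≡ y
mutEntry-pos-neg {x} {b} y 0≤x b≤0 =
  trans (mutEntry-nonpos x y b≤0)
        (trans (cong (λ u → y - u * (- b)) (pos-of-nonpos (ℤP.neg-mono-≤ 0≤x))) (lemma y (- b)))
  where lemma : ∀ y c → y - 0ℤ * c ≡ y
        lemma = solve-∀

mutEntry-zero : ∀ b y → mutEntry 0ℤ b y ≡ y
mutEntry-zero b y = lemma y (pos b) (pos (- b))
  where lemma : ∀ y u v → y + 0ℤ * u - 0ℤ * v ≡ y
        lemma = solve-∀

mutEntry-≥ : ∀ x {b} y → 0ℤ ≤ b → y ≤ mutEntry x b y
mutEntry-≥ x {b} y 0≤b =
  subst (y ≤_) (sym (mutEntry-nonneg x y 0≤b)) (≤-+-nonneg y (*-nonneg (pos-nonneg x) 0≤b))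

1≤mutEntry : ∀ {a b c} → 1ℤ ≤ a → 2ℤ ≤ b → 0ℤ ≤ c → 1ℤ ≤ mutEntry a b c
1≤mutEntry {a} {b} {c} 1≤a 2≤b 0≤c =
  ≤-slack (c + (a - 1ℤ) * b + (b - 2ℤ) + 1ℤ) (trans (mutEntry-pos-pos c (1≤⇒0≤ 1≤a) (2≤⇒0≤ 2≤b)) (lemma a b c))
    (+-nonneg (+-nonneg (+-nonneg 0≤c (*-nonneg (ℤP.i≤j⇒0≤j-i 1≤a) (2≤⇒0≤ 2≤b))) (ℤP.i≤j⇒0≤j-i 2≤b))
              (1≤⇒0≤ ℤP.≤-refl))
  where lemma : ∀ a b c → c + a * b ≡ 1ℤ + (c + (a - 1ℤ) * b + (b - + 2) + 1ℤ)
        lemma = solve-∀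

mutEntry-neg : ∀ x b y → mutEntry (- x) (- b) (- y) ≡ - mutEntry x b y
mutEntry-neg x b y rewrite ℤP.neg-involutive x | ℤP.neg-involutive b =
  lemma y (pos x) (pos b) (pos (- x)) (pos (- b))
  where lemma : ∀ y u v u′ v′ → - y + u′ * v′ - u * v ≡ - (y + u * v - u′ * v′)
        lemma = solve-∀

mutEntry-comm : ∀ x b y → mutEntry x b y ≡ mutEntry b x y
mutEntry-comm x b y = lemma y (pos x) (pos b) (pos (- x)) (pos (- b))
  where lemma : ∀ y u v u′ v′ → y + u * v - u′ * v′ ≡ y + v * u - v′ * u′
        lemma = solve-∀

mutEntry-skew : ∀ x b y → mutEntry x b y ≡ - mutEntry (- b) (- x) (- y)
mutEntry-skew x b y = begin
  mutEntry x b y                ≡⟨ mutEntry-comm x b y ⟩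
  mutEntry b x y                ≡⟨ sym (ℤP.neg-involutive _) ⟩
  - - mutEntry b x y            ≡⟨ cong -_ (sym (mutEntry-neg b x y)) ⟩
  - mutEntry (- b) (- x) (- y)  ∎
  where open ≡-Reasoning

-- The entries of a frozen row at three listed mutable vertices (x, y, z). Mutating at the
-- i-th listed vertex lists the result as (y, z, x), (y, x, z) and (z, y, x) for i = 1, 2, 3;
-- b₁ and b₂ are the exchange entries from the mutated vertex to the other two, in order.
Row : Set
Row = ℤ × ℤ × ℤ

zeroRow : Row
zeroRow = 0ℤ , 0ℤ , 0ℤ

mutate₁ mutate₂ mutate₃ : ℤ → ℤ → Row → Row
mutate₁ b₁ b₂ (x , y , z) = mutEntry x b₁ y , mutEntry x b₂ z , - x
mutate₂ b₁ b₂ (x , y , z) = - y , mutEntry y b₁ x , mutEntry y b₂ z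
mutate₃ b₁ b₂ (x , y , z) = mutate₂ b₁ b₂ (y , z , x)

-- In a cycle m → n → p → m, where m was mutated last, rows are listed (m, n, p) and the
-- next mutation is at the successor n or at the predecessor p of m.
data Move : Set where
  succ pred : Move

data CycStep : Move → Row → Row → Set where
  succ-step : ∀ {b₁ b₂} x → b₁ ≤ -2ℤ → 2ℤ ≤ b₂ → CycStep succ x (mutate₂ b₁ b₂ x)
  pred-step : ∀ {b₁ b₂} x → b₁ ≤ -2ℤ → 2ℤ ≤ b₂ → CycStep pred x (mutate₃ b₁ b₂ x)

-- In an acyclic quiver a → b → c with a → c, where c was mutated last, rows are listed
-- (a, b, c); mutating at the source a makes (b, c, a) the new such listing.
data SourceStep : Row → Row → Set where
  source-step : ∀ {b₁ b₂} x → 2ℤ ≤ b₁ → 2ℤ ≤ b₂ → SourceStep x (mutate₁ b₁ b₂ x)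

-- The cyclic regime

cycPotential : Row → ℤ
cycPotential (m , s , p) = (p - pos (- m)) ⊓ (- s - pos m)

CycGood : Row → Set
CycGood x = 1ℤ ≤ cycPotential x

cycGain : Move → Row → ℤ
cycGain succ (m , s , _) = pos (- m) + pos s
cycGain pred (m , _ , p) = pos m + pos (- p)

cycGain-nonneg : ∀ k x → 0ℤ ≤ cycGain k x
cycGain-nonneg succ (m , s , _) = +-nonneg (pos-nonneg (- m)) (pos-nonneg s)
cycGain-nonneg pred (m , _ , p) = +-nonneg (pos-nonneg m) (pos-nonneg (- p))

⊓-+-mono : ∀ a b g {a′ b′} → a + g ≤ a′ → b + g ≤ b′ → a ⊓ b + g ≤ a′ ⊓ b′
⊓-+-mono a b g a+g≤a′ b+g≤b′ = ℤP.⊓-glb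
  (ℤP.≤-trans (ℤP.+-monoˡ-≤ g (ℤP.i⊓j≤i a b)) a+g≤a′)
  (ℤP.≤-trans (ℤP.+-monoˡ-≤ g (ℤP.i⊓j≤j a b)) b+g≤b′)

cycPotential-step : ∀ {k x y} → CycStep k x y → cycPotential x + cycGain k x ≤ cycPotential y
cycPotential-step (succ-step {b₁} {b₂} (m , s , p) b₁≤-2 2≤b₂) =
  ⊓-+-mono (p - pos (- m)) (- s - pos m) (pos (- m) + pos s) first second
  where
    first : p - pos (- m) + (pos (- m) + pos s) ≤ mutEntry s b₂ p - pos (- - s)
    first = ≤-slack (pos s * (b₂ - 2ℤ))
      (trans (cong₂ (λ e t → e - pos t) (mutEntry-nonneg s p (2≤⇒0≤ 2≤b₂)) (ℤP.neg-involutive s))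
             (lemma p (pos (- m)) (pos s) b₂))
      (*-nonneg (pos-nonneg s) (ℤP.i≤j⇒0≤j-i 2≤b₂))
      where lemma : ∀ p u v b → p + v * b - v ≡ p - u + (u + v) + v * (b - + 2)
            lemma = solve-∀
    second : - s - pos m + (pos (- m) + pos s) ≤ - mutEntry s b₁ m - pos (- s)
    second = ≤-slack-gaps (pos (- s) * (- b₁ - 2ℤ)) s m
      (trans (cong (λ e → - e - pos (- s)) (mutEntry-nonpos s m (≤-2⇒≤0 b₁≤-2)))
             (lemma s m (pos s) (pos (- s)) (pos m) (pos (- m)) b₁))
      (*-nonneg (pos-nonneg (- s)) (ℤP.i≤j⇒0≤j-i (ℤP.neg-mono-≤ b₁≤-2)))
      where lemma : ∀ s m s⁺ s⁻ m⁺ m⁻ b → - (m - s⁻ * (- b)) - s⁻ ≡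
                      - s - m⁺ + (m⁻ + s⁺) + s⁻ * (- b - + 2) + ((s - (s⁺ - s⁻)) - (m - (m⁺ - m⁻)))
            lemma = solve-∀
cycPotential-step (pred-step {b₁} {b₂} (m , s , p) b₁≤-2 2≤b₂) =
  ⊓-+-mono (p - pos (- m)) (- s - pos m) (pos m + pos (- p)) first second
  where
    first : p - pos (- m) + (pos m + pos (- p)) ≤ mutEntry p b₂ m - pos (- - p)
    first = ≤-slack-gaps (pos p * (b₂ - 2ℤ)) m p
      (trans (cong₂ (λ e t → e - pos t) (mutEntry-nonneg p m (2≤⇒0≤ 2≤b₂)) (ℤP.neg-involutive p))
             (lemma m p (pos m) (pos (- m)) (pos p) (pos (- p)) b₂))
      (*-nonneg (pos-nonneg p) (ℤP.i≤j⇒0≤j-i 2≤b₂))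
      where lemma : ∀ m p m⁺ m⁻ p⁺ p⁻ b → m + p⁺ * b - p⁺ ≡
                      p - m⁻ + (m⁺ + p⁻) + p⁺ * (b - + 2) + ((m - (m⁺ - m⁻)) - (p - (p⁺ - p⁻)))
            lemma = solve-∀
    second : - s - pos m + (pos m + pos (- p)) ≤ - mutEntry p b₁ s - pos (- p)
    second = ≤-slack (pos (- p) * (- b₁ - 2ℤ))
      (trans (cong (λ e → - e - pos (- p)) (mutEntry-nonpos p s (≤-2⇒≤0 b₁≤-2)))
             (lemma s (pos m) (pos (- p)) b₁))
      (*-nonneg (pos-nonneg (- p)) (ℤP.i≤j⇒0≤j-i (ℤP.neg-mono-≤ b₁≤-2)))
      where lemma : ∀ s m⁺ p⁻ b → - (s - p⁻ * (- b)) - p⁻ ≡ - s - m⁺ + (m⁺ + p⁻) + p⁻ * (- b - + 2)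
            lemma = solve-∀

cycPotential-mono : ∀ {k x y} → CycStep k x y → cycPotential x ≤ cycPotential y
cycPotential-mono {k} {x} st = ℤP.≤-trans (≤-+-nonneg _ (cycGain-nonneg k x)) (cycPotential-step st)

cycGood-step : ∀ {k x y} → CycStep k x y → CycGood x → CycGood y
cycGood-step st good = ℤP.≤-trans good (cycPotential-mono st)

cycGood-signs : ∀ {m s p} → CycGood (m , s , p) → s ≤ -1ℤ × 1ℤ ≤ p
cycGood-signs {m} {s} {p} good =
  ℤP.neg-cancel-≤ (ℤP.≤-trans (ℤP.i≤j⊓k⇒i≤k (p - pos (- m)) _ good)
                             (ℤP.i-j≤i (- s) (pos m) {{ℤ.nonNegative (pos-nonneg m)}})) ,
  ℤP.≤-trans (ℤP.i≤j⊓k⇒i≤j _ (- s - pos m) good) (ℤP.i-j≤i p (pos (- m)) {{ℤ.nonNegative (pos-nonneg (- m))}})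

-- The form the invariant takes right after an acyclic quiver has turned into a cycle.
CycEntry : Row → Set
CycEntry (m , s , p) = m ≤ -1ℤ × 1ℤ ≤ s × 1ℤ ≤ p + m

cycEntry-signs : ∀ {m s p} → CycEntry (m , s , p) → 1ℤ ≤ s × 1ℤ ≤ p
cycEntry-signs {m} {s} {p} (m≤-1 , 1≤s , 1≤p+m) =
  1≤s , ≤-slack ((p + m - 1ℤ) + (-1ℤ - m) + 1ℤ) (lemma p m)
          (+-nonneg (+-nonneg (ℤP.i≤j⇒0≤j-i 1≤p+m) (ℤP.i≤j⇒0≤j-i m≤-1)) (1≤⇒0≤ ℤP.≤-refl))
  where lemma : ∀ p m → p ≡ 1ℤ + ((p + m - 1ℤ) + (- 1ℤ - m) + 1ℤ)
        lemma = solve-∀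

cycEntry-succ : ∀ {x y} → CycStep succ x y → CycEntry x → CycGood y
cycEntry-succ (succ-step {b₁} {b₂} (m , s , p) b₁≤-2 2≤b₂) entry@(m≤-1 , 1≤s , _) = ℤP.⊓-glb first second
  where
    0≤s : 0ℤ ≤ s
    0≤s = 1≤⇒0≤ 1≤s
    1≤p : 1ℤ ≤ p
    1≤p = proj₂ (cycEntry-signs {m} {s} {p} entry)
    first : 1ℤ ≤ mutEntry s b₂ p - pos (- - s)
    first = ≤-slack ((p - 1ℤ) + s * (b₂ - 2ℤ) + s)
      (trans (cong₂ (λ e t → e - pos t) (mutEntry-pos-pos p 0≤s (2≤⇒0≤ 2≤b₂)) (ℤP.neg-involutive s))
        (trans (cong (λ t → p + s * b₂ - t) (pos-of-nonneg 0≤s)) (lemma p s b₂)))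
      (+-nonneg (+-nonneg (ℤP.i≤j⇒0≤j-i 1≤p) (*-nonneg 0≤s (ℤP.i≤j⇒0≤j-i 2≤b₂))) 0≤s)
      where lemma : ∀ p s b → p + s * b - s ≡ 1ℤ + ((p - 1ℤ) + s * (b - + 2) + s)
            lemma = solve-∀
    second : 1ℤ ≤ - mutEntry s b₁ m - pos (- s)
    second = ≤-slack (-1ℤ - m)
      (trans (cong₂ (λ e t → - e - t) (mutEntry-pos-neg m 0≤s (≤-2⇒≤0 b₁≤-2))
                                     (pos-of-nonpos (ℤP.neg-mono-≤ 0≤s)))
        (lemma m))
      (ℤP.i≤j⇒0≤j-i m≤-1)
      where lemma : ∀ m → - m - 0ℤ ≡ 1ℤ + (- 1ℤ - m)
            lemma = solve-∀

cycEntry-pred : ∀ {x y} → CycStep pred x y → CycEntry x → CycEntry y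
cycEntry-pred (pred-step {b₁} {b₂} (m , s , p) b₁≤-2 2≤b₂) entry@(_ , 1≤s , 1≤p+m) =
  ℤP.neg-mono-≤ 1≤p ,
  subst (1ℤ ≤_) (sym (mutEntry-pos-neg s 0≤p (≤-2⇒≤0 b₁≤-2))) 1≤s ,
  ≤-slack ((p + m - 1ℤ) + p * (b₂ - 2ℤ))
    (trans (cong (_- p) (mutEntry-pos-pos m 0≤p (2≤⇒0≤ 2≤b₂))) (lemma p m b₂))
    (+-nonneg (ℤP.i≤j⇒0≤j-i 1≤p+m) (*-nonneg 0≤p (ℤP.i≤j⇒0≤j-i 2≤b₂)))
  where
    1≤p : 1ℤ ≤ p
    1≤p = proj₂ (cycEntry-signs {m} {s} {p} entry)
    0≤p : 0ℤ ≤ p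
    0≤p = 1≤⇒0≤ 1≤p
    lemma : ∀ p m b → m + p * b - p ≡ 1ℤ + ((p + m - 1ℤ) + p * (b - + 2))
    lemma = solve-∀

gain-succ≡0 : ∀ {m s p} → cycGain succ (m , s , p) ≡ 0ℤ → 0ℤ ≤ m × s ≤ 0ℤ
gain-succ≡0 {m} {s} eq with nonneg-sum≡0 (pos-nonneg (- m)) (pos-nonneg s) eq
... | e₁ , e₂ = ℤP.neg-cancel-≤ (pos≡0⇒≤0 e₁) , pos≡0⇒≤0 e₂

gain-pred≡0 : ∀ {m s p} → cycGain pred (m , s , p) ≡ 0ℤ → m ≤ 0ℤ × 0ℤ ≤ p
gain-pred≡0 {m} {p = p} eq with nonneg-sum≡0 (pos-nonneg m) (pos-nonneg (- p)) eq
... | e₁ , e₂ = pos≡0⇒≤0 e₁ , ℤP.neg-cancel-≤ (pos≡0⇒≤0 e₂)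

-- m₀ and p₀ are the first and last entries of the row at the start of a zero-gain window.
PredRunInv : ℤ → ℤ → Row → Set
PredRunInv m₀ p₀ (m , s , p) = s ≡ m₀ × p₀ ≤ p × 0ℤ ≤ p + m

PredRunExit : ℤ → ℤ → Row → Set
PredRunExit m₀ p₀ (m , s , _) = s ≡ m₀ × m + p₀ ≤ 0ℤ

window-start : ∀ {m s p y} → CycStep succ (m , s , p) y →
  cycGain succ (m , s , p) ≡ 0ℤ → cycGain pred y ≡ 0ℤ →
  s ≡ 0ℤ × 0ℤ ≤ m × 0ℤ ≤ p × PredRunInv m p y
window-start {m} {s} {p} (succ-step {b₁} {b₂} _ _ _) g₀ g₁ =
  s≡0 , 0≤m , subst (0ℤ ≤_) p′≡p 0≤p′ ,
  trans (cong (λ t → mutEntry t b₁ m) s≡0) (mutEntry-zero b₁ m) ,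
  ℤP.≤-reflexive (sym p′≡p) ,
  ℤP.≤-trans 0≤p′ (≤-+-nonneg _ (ℤP.neg-mono-≤ s≤0))
  where
    0≤m : 0ℤ ≤ m
    0≤m = proj₁ (gain-succ≡0 {m} {s} {p} g₀)
    s≤0 : s ≤ 0ℤ
    s≤0 = proj₂ (gain-succ≡0 {m} {s} {p} g₀)
    0≤p′ : 0ℤ ≤ mutEntry s b₂ p
    0≤p′ = proj₂ (gain-pred≡0 { - s} {mutEntry s b₁ m} {mutEntry s b₂ p} g₁)
    s≡0 : s ≡ 0ℤ
    s≡0 = ℤP.≤-antisym s≤0 (ℤP.neg-cancel-≤ (proj₁ (gain-pred≡0 { - s} {mutEntry s b₁ m} {mutEntry s b₂ p} g₁)))
    p′≡p : mutEntry s b₂ p ≡ p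
    p′≡p = trans (cong (λ t → mutEntry t b₂ p) s≡0) (mutEntry-zero b₂ p)

pred-run-step : ∀ {m₀ p₀ x y} → CycStep pred x y → cycGain pred x ≡ 0ℤ →
  PredRunInv m₀ p₀ x → PredRunInv m₀ p₀ y × PredRunExit m₀ p₀ y
pred-run-step {m₀} {p₀} (pred-step {b₁} {b₂} (m , s , p) b₁≤-2 2≤b₂) g (s≡m₀ , p₀≤p , 0≤p+m) =
  (s′≡m₀ , ℤP.≤-trans p₀≤p (≤-slack slack (trans p′≡ (lemma₁ p m b₂)) 0≤slack) ,
   ≤-slack slack (trans (cong (_- p) p′≡) (lemma₂ p m b₂)) 0≤slack) ,
  s′≡m₀ , subst (_≤ 0ℤ) (ℤP.+-comm p₀ (- p)) (ℤP.i≤j⇒i-j≤0 p₀≤p)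
  where
    0≤p : 0ℤ ≤ p
    0≤p = proj₂ (gain-pred≡0 {m} {s} {p} g)
    slack : ℤ
    slack = (p + m) + p * (b₂ - 2ℤ)
    0≤slack : 0ℤ ≤ slack
    0≤slack = +-nonneg 0≤p+m (*-nonneg 0≤p (ℤP.i≤j⇒0≤j-i 2≤b₂))
    s′≡m₀ : mutEntry p b₁ s ≡ m₀
    s′≡m₀ = trans (mutEntry-pos-neg s 0≤p (≤-2⇒≤0 b₁≤-2)) s≡m₀
    p′≡ : mutEntry p b₂ m ≡ m + p * b₂
    p′≡ = mutEntry-pos-pos m 0≤p (2≤⇒0≤ 2≤b₂)
    lemma₁ : ∀ p m b → m + p * b ≡ p + ((p + m) + p * (b - + 2))
    lemma₁ = solve-∀
    lemma₂ : ∀ p m b → m + p * b - p ≡ 0ℤ + ((p + m) + p * (b - + 2))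
    lemma₂ = solve-∀

window-end : ∀ {m₀ p₀} x → PredRunExit m₀ p₀ x → cycGain succ x ≡ 0ℤ → m₀ ≤ 0ℤ × p₀ ≤ 0ℤ
window-end {m₀} {p₀} (m , s , p) (s≡m₀ , m+p₀≤0) g =
  subst (_≤ 0ℤ) s≡m₀ (proj₂ (gain-succ≡0 {m} {s} {p} g)) ,
  ℤP.≤-trans (ℤP.i≤j+i p₀ m {{ℤ.nonNegative (proj₁ (gain-succ≡0 {m} {s} {p} g))}}) m+p₀≤0

-- The acyclic regime

acycPotential : Row → ℤ
acycPotential (a , b , c) = a - pos (- b) - pos (- c)

acycGain : Row → ℤ
acycGain (a , b , _) = pos b + pos (- a)

acycPotential-step : ∀ {x y} → SourceStep x y → acycPotential x + acycGain x ≤ acycPotential y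
acycPotential-step (source-step {b₁} {b₂} (a , b , c) 2≤b₁ 2≤b₂) =
  ≤-slack-gaps (pos a * (b₁ - 2ℤ) + (pos (- c) - q)) b a
    (trans (cong₂ (λ u v → u - pos (- v) - pos (- - a))
                  (mutEntry-nonneg a b (2≤⇒0≤ 2≤b₁)) (mutEntry-nonneg a c (2≤⇒0≤ 2≤b₂)))
      (trans (cong (λ t → b + pos a * b₁ - q - pos t) (ℤP.neg-involutive a))
        (lemma a b (pos a) (pos (- a)) (pos b) (pos (- b)) (pos (- c)) q b₁)))
    (+-nonneg (*-nonneg (pos-nonneg a) (ℤP.i≤j⇒0≤j-i 2≤b₁)) (ℤP.i≤j⇒0≤j-i (pos-mono (ℤP.neg-mono-≤ c≤c′))))
  where
    q : ℤ
    q = pos (- (c + pos a * b₂))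
    c≤c′ : c ≤ c + pos a * b₂
    c≤c′ = ≤-+-nonneg c (*-nonneg (pos-nonneg a) (2≤⇒0≤ 2≤b₂))
    lemma : ∀ a b a⁺ a⁻ b⁺ b⁻ c⁻ q b₁ → b + a⁺ * b₁ - q - a⁺ ≡
              a - b⁻ - c⁻ + (b⁺ + a⁻) + (a⁺ * (b₁ - + 2) + (c⁻ - q)) + ((b - (b⁺ - b⁻)) - (a - (a⁺ - a⁻)))
    lemma = solve-∀

acycPotential-mono : ∀ {x y} → SourceStep x y → acycPotential x ≤ acycPotential y
acycPotential-mono {a , b , _} st =
  ℤP.≤-trans (≤-+-nonneg _ (+-nonneg (pos-nonneg b) (pos-nonneg (- a)))) (acycPotential-step st)

data Strict : Row → Set where
  middle-pos          : ∀ {a b c} → 1ℤ ≤ b → Strict (a , b , c)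
  source-neg          : ∀ {a b c} → a ≤ -1ℤ → Strict (a , b , c)
  source-pos-sink-neg : ∀ {a b c} → 1ℤ ≤ a → c ≤ -1ℤ → Strict (a , b , c)

acycPotential-strict : ∀ {x y} → SourceStep x y → Strict x → acycPotential x + 1ℤ ≤ acycPotential y
acycPotential-strict st@(source-step (a , b , c) _ _) (middle-pos 1≤b) =
  ℤP.≤-trans (ℤP.+-monoʳ-≤ (acycPotential (a , b , c))
               (ℤP.≤-trans (subst (1ℤ ≤_) (sym (pos-of-nonneg (1≤⇒0≤ 1≤b))) 1≤b)
                           (≤-+-nonneg (pos b) (pos-nonneg (- a)))))
             (acycPotential-step st)
acycPotential-strict st@(source-step (a , b , c) _ _) (source-neg a≤-1) =
  ℤP.≤-trans (ℤP.+-monoʳ-≤ (acycPotential (a , b , c))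
               (ℤP.≤-trans (subst (1ℤ ≤_) (sym (pos-of-nonneg (1≤⇒0≤ (ℤP.neg-mono-≤ a≤-1))))
                                  (ℤP.neg-mono-≤ a≤-1))
                           (ℤP.i≤j+i (pos (- a)) (pos b) {{ℤ.nonNegative (pos-nonneg b)}})))
             (acycPotential-step st)
acycPotential-strict (source-step {b₁} {b₂} (a , b , c) 2≤b₁ 2≤b₂) (source-pos-sink-neg 1≤a c≤-1) =
  ≤-slack-gap (pos b + a * (b₁ - 2ℤ) + (pos (- c) - 1ℤ - q)) b
    (trans (cong₂ (λ u v → u - pos (- v) - pos (- - a))
                  (mutEntry-pos-pos b 0≤a (2≤⇒0≤ 2≤b₁)) (mutEntry-pos-pos c 0≤a (2≤⇒0≤ 2≤b₂)))
      (trans (cong (λ t → b + a * b₁ - q - t) (trans (cong pos (ℤP.neg-involutive a)) (pos-of-nonneg 0≤a)))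
        (lemma a b (pos b) (pos (- b)) (pos (- c)) q b₁)))
    (+-nonneg (+-nonneg (pos-nonneg b) (*-nonneg 0≤a (ℤP.i≤j⇒0≤j-i 2≤b₁))) (ℤP.i≤j⇒0≤j-i q≤c⁻-1))
  where
    0≤a : 0ℤ ≤ a
    0≤a = 1≤⇒0≤ 1≤a
    q : ℤ
    q = pos (- (c + a * b₂))
    q≤c⁻-1 : q ≤ pos (- c) - 1ℤ
    q≤c⁻-1 = subst (λ t → q ≤ t - 1ℤ) (sym (pos-of-nonneg (ℤP.neg-mono-≤ (≤-1⇒≤0 c≤-1))))
     (subst (q ≤_) (pos-of-nonneg (ℤP.i≤j⇒0≤j-i (ℤP.neg-mono-≤ c≤-1)))
      (pos-mono (≤-slack ((a - 1ℤ) * b₂ + (b₂ - 2ℤ) + 1ℤ) (lemma₂ a c b₂)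
        (+-nonneg (+-nonneg (*-nonneg (ℤP.i≤j⇒0≤j-i 1≤a) (2≤⇒0≤ 2≤b₂)) (ℤP.i≤j⇒0≤j-i 2≤b₂))
                  (1≤⇒0≤ ℤP.≤-refl)))))
      where lemma₂ : ∀ a c b → - c - 1ℤ ≡ - (c + a * b) + ((a - 1ℤ) * b + (b - + 2) + 1ℤ)
            lemma₂ = solve-∀
    lemma : ∀ a b b⁺ b⁻ c⁻ q b₁ → b + a * b₁ - q - a ≡
              a - b⁻ - c⁻ + 1ℤ + (b⁺ + a * (b₁ - + 2) + (c⁻ - 1ℤ - q)) + (b - (b⁺ - b⁻))
    lemma = solve-∀

data Sign (x : ℤ) : Set where
  negative : x ≤ -1ℤ → Sign x
  null     : x ≡ 0ℤ → Sign x
  positive : 1ℤ ≤ x → Sign x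

sign : ∀ x → Sign x
sign -[1+ n ]  = negative (ℤ.-≤- z≤n)
sign (+ zero)  = null refl
sign (+ suc n) = positive (ℤ.+≤+ (s≤s z≤n))

strict-within-two : ∀ {x₀ x₁ x₂} → SourceStep x₀ x₁ → SourceStep x₁ x₂ → x₀ ≢ zeroRow →
  Strict x₀ ⊎ Strict x₁ ⊎ Strict x₂
strict-within-two (source-step {b₁} {b₂} (a , b , c) _ 2≤b₂) (source-step {b₃} _ _ _) x₀≢0 with sign a
... | negative a≤-1 = inj₁ (source-neg a≤-1)
... | positive 1≤a with sign c
...   | negative c≤-1 = inj₁ (source-pos-sink-neg 1≤a c≤-1)
...   | null c≡0      = inj₂ (inj₁ (middle-pos (1≤mutEntry 1≤a 2≤b₂ (ℤP.≤-reflexive (sym c≡0)))))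
...   | positive 1≤c  = inj₂ (inj₁ (middle-pos (1≤mutEntry 1≤a 2≤b₂ (1≤⇒0≤ 1≤c))))
strict-within-two (source-step {b₁} {b₂} (a , b , c) _ 2≤b₂) (source-step {b₃} _ _ _) x₀≢0 | null refl with sign b
... | positive 1≤b  = inj₁ (middle-pos 1≤b)
... | negative b≤-1 = inj₂ (inj₁ (source-neg (subst (_≤ -1ℤ) (sym (mutEntry-zero b₁ b)) b≤-1)))
... | null refl with sign c
...   | positive 1≤c  = inj₂ (inj₁ (middle-pos (subst (1ℤ ≤_) (sym (mutEntry-zero b₂ c)) 1≤c)))
...   | negative c≤-1 = inj₂ (inj₂ (source-neg (subst (_≤ -1ℤ) (sym a₂≡c) c≤-1)))
  where a₂≡c : mutEntry (mutEntry 0ℤ b₁ 0ℤ) b₃ (mutEntry 0ℤ b₂ c) ≡ c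
        a₂≡c = trans (cong₂ (λ u v → mutEntry u b₃ v) (mutEntry-zero b₁ 0ℤ) (mutEntry-zero b₂ c))
                     (mutEntry-zero b₃ c)
...   | null refl = ⊥-elim (x₀≢0 refl)

three-steps-rise : ∀ {x₀ x₁ x₂ x₃} → SourceStep x₀ x₁ → SourceStep x₁ x₂ → SourceStep x₂ x₃ →
  x₀ ≢ zeroRow → acycPotential x₀ + 1ℤ ≤ acycPotential x₃
three-steps-rise s₁ s₂ s₃ x₀≢0 with strict-within-two s₁ s₂ x₀≢0
... | inj₁ strict =
  ℤP.≤-trans (acycPotential-strict s₁ strict) (ℤP.≤-trans (acycPotential-mono s₂) (acycPotential-mono s₃))
... | inj₂ (inj₁ strict) =
  ℤP.≤-trans (ℤP.+-monoˡ-≤ 1ℤ (acycPotential-mono s₁))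
             (ℤP.≤-trans (acycPotential-strict s₂ strict) (acycPotential-mono s₃))
... | inj₂ (inj₂ strict) =
  ℤP.≤-trans (ℤP.+-monoˡ-≤ 1ℤ (ℤP.≤-trans (acycPotential-mono s₁) (acycPotential-mono s₂)))
             (acycPotential-strict s₃ strict)

AcycGood : Row → Set
AcycGood (a , b , c) = 1ℤ ≤ acycPotential (a , b , c) × 1ℤ ≤ a × 1ℤ ≤ b × 1ℤ ≤ b + c

acycGood-step : ∀ {x y} → SourceStep x y → 1ℤ ≤ acycPotential x → AcycGood y
acycGood-step st@(source-step {b₁} {b₂} (a , b , c) 2≤b₁ 2≤b₂) 1≤ψ =
  ℤP.≤-trans 1≤ψ (acycPotential-mono st) ,
  ≤-slack-gap (pos b + a * (b₁ - 2ℤ) + a + (ψ - 1ℤ) + pos (- c)) b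
    (trans (mutEntry-pos-pos b 0≤a (2≤⇒0≤ 2≤b₁)) (lemma₁ a b (pos b) (pos (- b)) (pos (- c)) b₁))
    (+-nonneg (+-nonneg (+-nonneg (+-nonneg (pos-nonneg b) (*-nonneg 0≤a (ℤP.i≤j⇒0≤j-i 2≤b₁))) 0≤a) 0≤ψ-1)
              (pos-nonneg (- c))) ,
  ≤-slack-gap (pos c + a * (b₂ - 2ℤ) + a + (ψ - 1ℤ) + pos (- b)) c
    (trans (mutEntry-pos-pos c 0≤a (2≤⇒0≤ 2≤b₂)) (lemma₂ a c (pos c) (pos (- b)) (pos (- c)) b₂))
    (+-nonneg (+-nonneg (+-nonneg (+-nonneg (pos-nonneg c) (*-nonneg 0≤a (ℤP.i≤j⇒0≤j-i 2≤b₂))) 0≤a) 0≤ψ-1)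
              (pos-nonneg (- b))) ,
  ≤-slack-gap (pos c + a * (b₂ - 2ℤ) + (ψ - 1ℤ) + pos (- b)) c
    (trans (cong (_- a) (mutEntry-pos-pos c 0≤a (2≤⇒0≤ 2≤b₂))) (lemma₃ a c (pos c) (pos (- b)) (pos (- c)) b₂))
    (+-nonneg (+-nonneg (+-nonneg (pos-nonneg c) (*-nonneg 0≤a (ℤP.i≤j⇒0≤j-i 2≤b₂))) 0≤ψ-1) (pos-nonneg (- b)))
  where
    ψ : ℤ
    ψ = acycPotential (a , b , c)
    0≤ψ-1 : 0ℤ ≤ ψ - 1ℤ
    0≤ψ-1 = ℤP.i≤j⇒0≤j-i 1≤ψ
    0≤a : 0ℤ ≤ a
    0≤a = ℤP.≤-trans (1≤⇒0≤ 1≤ψ)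
            (ℤP.≤-trans (ℤP.i-j≤i (a - pos (- b)) (pos (- c)) {{ℤ.nonNegative (pos-nonneg (- c))}})
                        (ℤP.i-j≤i a (pos (- b)) {{ℤ.nonNegative (pos-nonneg (- b))}}))
    lemma₁ : ∀ a b b⁺ b⁻ c⁻ k → b + a * k ≡
               1ℤ + (b⁺ + a * (k - + 2) + a + (a - b⁻ - c⁻ - 1ℤ) + c⁻) + (b - (b⁺ - b⁻))
    lemma₁ = solve-∀
    lemma₂ : ∀ a c c⁺ b⁻ c⁻ k → c + a * k ≡
               1ℤ + (c⁺ + a * (k - + 2) + a + (a - b⁻ - c⁻ - 1ℤ) + b⁻) + (c - (c⁺ - c⁻))
    lemma₂ = solve-∀
    lemma₃ : ∀ a c c⁺ b⁻ c⁻ k → c + a * k - a ≡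
               1ℤ + (c⁺ + a * (k - + 2) + (a - b⁻ - c⁻ - 1ℤ) + b⁻) + (c - (c⁺ - c⁻))
    lemma₃ = solve-∀

-- Mutating an acyclic quiver at its middle vertex b turns (a, b, c) into the cyclic listing
-- (b, a, c) of b → a → c → b, by the same formula as a succ move.
acycGood-middle : ∀ {x y} → CycStep succ x y → AcycGood x → CycEntry y
acycGood-middle (succ-step {u} {v} (a , b , c) u≤-2 2≤v) (_ , 1≤a , 1≤b , 1≤b+c) =
  ℤP.neg-mono-≤ 1≤b ,
  subst (1ℤ ≤_) (sym (mutEntry-pos-neg a 0≤b (≤-2⇒≤0 u≤-2))) 1≤a ,
  ≤-slack ((b + c - 1ℤ) + b * (v - 2ℤ))
    (trans (cong (_- b) (mutEntry-pos-pos c 0≤b (2≤⇒0≤ 2≤v))) (lemma b c v))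
    (+-nonneg (ℤP.i≤j⇒0≤j-i 1≤b+c) (*-nonneg 0≤b (ℤP.i≤j⇒0≤j-i 2≤v)))
  where
    0≤b : 0ℤ ≤ b
    0≤b = 1≤⇒0≤ 1≤b
    lemma : ∀ b c v → c + b * v - b ≡ 1ℤ + ((b + c - 1ℤ) + b * (v - + 2))
    lemma = solve-∀

first-after : ∀ {P : ℕ → Set} → (∀ n → Dec (P n)) → ∀ d i → P (d ℕ.+ i) →
  ∃ λ k → P (k ℕ.+ i) × ∀ j → j ℕ.< k → ¬ P (j ℕ.+ i)
first-after P? zero i p = 0 , p , λ _ ()
first-after {P} P? (suc d) i p with P? i
... | yes pᵢ = 0 , pᵢ , λ _ ()
... | no ¬pᵢ with first-after P? d (suc i) (subst P (sym (ℕP.+-suc d i)) p)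
...   | k , pₖ , before = suc k , subst P (ℕP.+-suc k i) pₖ , earlier
  where
    earlier : ∀ j → j ℕ.< suc k → ¬ P (j ℕ.+ i)
    earlier zero    _         = ¬pᵢ
    earlier (suc j) (s≤s j<k) = before j j<k ∘ subst P (sym (ℕP.+-suc j i))

_≟ₘ_ : (μ ν : Move) → Dec (μ ≡ ν)
succ ≟ₘ succ = yes refl
succ ≟ₘ pred = no λ ()
pred ≟ₘ succ = no λ ()
pred ≟ₘ pred = yes refl

≢succ⇒pred : ∀ {μ} → ¬ μ ≡ succ → μ ≡ pred
≢succ⇒pred {succ} μ≢succ = ⊥-elim (μ≢succ refl)
≢succ⇒pred {pred} _      = refl

≢pred⇒succ : ∀ {μ} → ¬ μ ≡ pred → μ ≡ succ
≢pred⇒succ {succ} _      = refl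
≢pred⇒succ {pred} μ≢pred = ⊥-elim (μ≢pred refl)

module CyclicRun (kind : ℕ → Move) where

  InfinitelyOften : Move → Set
  InfinitelyOften μ = ∀ N → ∃ λ d → kind (d ℕ.+ N) ≡ μ

  record Window (q k : ℕ) : Set where
    field
      nonempty : 1 ℕ.≤ k
      opens    : kind q ≡ succ
      run      : ∀ j → j ℕ.< k → kind (suc j ℕ.+ q) ≡ pred
      closes   : kind (suc k ℕ.+ q) ≡ succ

  last-succ-before-pred : InfinitelyOften pred → ∀ s → kind s ≡ succ →
    ∃ λ q → s ℕ.≤ q × kind q ≡ succ × kind (suc q) ≡ pred
  last-succ-before-pred infPred s kₛ with infPred (suc s)
  ... | d , kₜ with first-after (λ n → kind n ≟ₘ pred) d (suc s) kₜ
  ...   | zero , kp , _ = s , ℕP.≤-refl , kₛ , kp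
  ...   | suc k , kp , before =
    suc k ℕ.+ s , ℕP.m≤n+m s (suc k) ,
    subst (λ n → kind n ≡ succ) (ℕP.+-suc k s) (≢pred⇒succ (before k ℕP.≤-refl)) ,
    subst (λ n → kind n ≡ pred) (ℕP.+-suc (suc k) s) kp

  window-at : InfinitelyOften succ → ∀ q → kind q ≡ succ → kind (suc q) ≡ pred → ∃ (Window q)
  window-at infSucc q k₀ k₁ with infSucc (suc q)
  ... | d , kₜ with first-after (λ n → kind n ≟ₘ succ) d (suc q) kₜ
  ...   | zero , ks , _ = ⊥-elim (pred≢succ (trans (sym k₁) ks))
    where pred≢succ : ¬ pred ≡ succ
          pred≢succ ()
  ...   | suc k , ks , before = suc k , record
    { nonempty = s≤s z≤n
    ; opens    = k₀
    ; run      = λ j j<k → subst (λ n → kind n ≡ pred) (ℕP.+-suc j q) (≢succ⇒pred (before j j<k))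
    ; closes   = subst (λ n → kind n ≡ succ) (ℕP.+-suc (suc k) q) ks
    }

  window-after : InfinitelyOften succ → InfinitelyOften pred → ∀ N → ∃₂ λ q k → N ℕ.≤ q × Window q k
  window-after infSucc infPred N with infSucc N
  ... | d , kₛ with last-succ-before-pred infPred (d ℕ.+ N) kₛ
  ...   | q , s≤q , k₀ , k₁ with window-at infSucc q k₀ k₁
  ...     | k , w = q , k , ℕP.≤-trans (ℕP.m≤n+m N d) s≤q , w

  module Along (row : ℕ → Row) (steps : ∀ i → CycStep (kind i) (row i) (row (suc i))) where

    potential-mono : ∀ d i → cycPotential (row i) ≤ cycPotential (row (d ℕ.+ i))
    potential-mono zero    i = ℤP.≤-refl
    potential-mono (suc d) i = ℤP.≤-trans (potential-mono d i) (cycPotential-mono (steps (d ℕ.+ i)))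

    ZeroGainAt : ℕ → Set
    ZeroGainAt i = cycGain (kind i) (row i) ≡ 0ℤ

    zero-gain-window : ∀ {q k} → Window q k → (∀ j → j ℕ.≤ suc k → ZeroGainAt (j ℕ.+ q)) → row q ≡ zeroRow
    zero-gain-window {q} {suc k′} w flat =
      cong₂ _,_ (ℤP.≤-antisym (proj₁ ends) 0≤m₀) (cong₂ _,_ s₀≡0 (ℤP.≤-antisym (proj₂ ends) 0≤p₀))
      where
        k : ℕ
        k = suc k′
        m₀ p₀ : ℤ
        m₀ = proj₁ (row q)
        p₀ = proj₂ (proj₂ (row q))
        start : proj₁ (proj₂ (row q)) ≡ 0ℤ × 0ℤ ≤ m₀ × 0ℤ ≤ p₀ × PredRunInv m₀ p₀ (row (suc q))
        start = window-start (subst (λ μ → CycStep μ (row q) (row (suc q))) (Window.opens w) (steps q))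
                  (subst (λ μ → cycGain μ (row q) ≡ 0ℤ) (Window.opens w) (flat 0 z≤n))
                  (subst (λ μ → cycGain μ (row (suc q)) ≡ 0ℤ) (Window.run w 0 (s≤s z≤n)) (flat 1 (s≤s z≤n)))
        s₀≡0 : proj₁ (proj₂ (row q)) ≡ 0ℤ
        s₀≡0 = proj₁ start
        0≤m₀ : 0ℤ ≤ m₀
        0≤m₀ = proj₁ (proj₂ start)
        0≤p₀ : 0ℤ ≤ p₀
        0≤p₀ = proj₁ (proj₂ (proj₂ start))
        pred-at : ∀ j → j ℕ.< k → CycStep pred (row (suc j ℕ.+ q)) (row (suc (suc j) ℕ.+ q))
        pred-at j j<k = subst (λ μ → CycStep μ _ _) (Window.run w j j<k) (steps (suc j ℕ.+ q))
        flat-pred : ∀ j → j ℕ.< k → cycGain pred (row (suc j ℕ.+ q)) ≡ 0ℤ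
        flat-pred j j<k = subst (λ μ → cycGain μ (row (suc j ℕ.+ q)) ≡ 0ℤ) (Window.run w j j<k)
                                (flat (suc j) (s≤s (ℕP.<⇒≤ j<k)))
        through : ∀ j → j ℕ.< k →
          PredRunInv m₀ p₀ (row (suc (suc j) ℕ.+ q)) × PredRunExit m₀ p₀ (row (suc (suc j) ℕ.+ q))
        through zero    0<k        = pred-run-step (pred-at 0 0<k) (flat-pred 0 0<k) (proj₂ (proj₂ (proj₂ start)))
        through (suc j) (s≤s j<k′) = pred-run-step (pred-at (suc j) (s≤s j<k′)) (flat-pred (suc j) (s≤s j<k′))
                                                   (proj₁ (through j (ℕP.m≤n⇒m≤1+n j<k′)))
        ends : m₀ ≤ 0ℤ × p₀ ≤ 0ℤ
        ends = window-end (row (suc k ℕ.+ q)) (proj₂ (through k′ ℕP.≤-refl))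
                 (subst (λ μ → cycGain μ (row (suc k ℕ.+ q)) ≡ 0ℤ) (Window.closes w) (flat (suc k) ℕP.≤-refl))

    rise-or-flat : ∀ q d → cycPotential (row q) + 1ℤ ≤ cycPotential (row (d ℕ.+ q)) ⊎
                           (∀ j → j ℕ.< d → ZeroGainAt (j ℕ.+ q))
    rise-or-flat q zero = inj₂ λ _ ()
    rise-or-flat q (suc d) with rise-or-flat q d
    ... | inj₁ rise = inj₁ (ℤP.≤-trans rise (cycPotential-mono (steps (d ℕ.+ q))))
    ... | inj₂ flat with cycGain (kind (d ℕ.+ q)) (row (d ℕ.+ q)) ℤP.≟ 0ℤ
    ...   | yes g≡0 = inj₂ flat′
      where
        flat′ : ∀ j → j ℕ.< suc d → ZeroGainAt (j ℕ.+ q)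
        flat′ j (s≤s j≤d) with ℕP.m≤n⇒m<n∨m≡n j≤d
        ... | inj₁ j<d  = flat j j<d
        ... | inj₂ refl = g≡0
    ...   | no g≢0 = inj₁ (ℤP.≤-trans (ℤP.+-mono-≤ (potential-mono d q) 1≤g) (cycPotential-step (steps (d ℕ.+ q))))
      where
        1≤g : 1ℤ ≤ cycGain (kind (d ℕ.+ q)) (row (d ℕ.+ q))
        1≤g = ℤP.i<j⇒suc[i]≤j (ℤP.≤∧≢⇒< (cycGain-nonneg (kind (d ℕ.+ q)) (row (d ℕ.+ q))) (g≢0 ∘ sym))

    window-rise : ∀ {q k} → Window q k → row q ≢ zeroRow →
      cycPotential (row q) + 1ℤ ≤ cycPotential (row (suc (suc k) ℕ.+ q))
    window-rise {q} {k} w row≢0 with rise-or-flat q (suc (suc k))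
    ... | inj₁ rise = rise
    ... | inj₂ flat = ⊥-elim (row≢0 (zero-gain-window w (λ j j≤k+1 → flat j (s≤s j≤k+1))))

Fin-bound : ∀ {g} (h : Fin g → ℕ) → ∃ λ n → ∀ i → h i ℕ.≤ n
Fin-bound {zero}  h = 0 , λ ()
Fin-bound {suc g} h with Fin-bound (λ i → h (Fin.suc i))
... | n , bound = h Fin.zero ℕ.+ n , λ where
  Fin.zero    → ℕP.m≤m+n (h Fin.zero) n
  (Fin.suc i) → ℕP.≤-trans (bound i) (ℕP.m≤n+m n (h Fin.zero))

1≤i+suc∣i∣ : ∀ {n} i → ∣ i ∣ ℕ.≤ n → 1ℤ ≤ i + + suc n
1≤i+suc∣i∣ {n} (+ m)    _   = ℤ.+≤+ (ℕP.≤-trans (s≤s z≤n) (ℕP.m≤n+m (suc n) m))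
1≤i+suc∣i∣ {n} -[1+ m ] m<n =
  subst (1ℤ ≤_) (sym (ℤP.⊖-≥ (ℕP.m≤n⇒m≤1+n m<n))) (ℤ.+≤+ (ℕP.m<n⇒0<n∸m m<n))

module Climb {S E : Set} {g : ℕ} (Φ : S → Fin g → ℤ)
             (rise : ∀ s → E ⊎ Σ S λ s′ → ∀ i → Φ s i + 1ℤ ≤ Φ s′ i) where

  climb : ∀ n s → E ⊎ Σ S λ s′ → ∀ i → Φ s i + + n ≤ Φ s′ i
  climb zero s = inj₂ (s , λ i → ℤP.≤-reflexive (ℤP.+-identityʳ (Φ s i)))
  climb (suc n) s with climb n s
  ... | inj₁ e = inj₁ e
  ... | inj₂ (s′ , h) with rise s′
  ...   | inj₁ e = inj₁ e
  ...   | inj₂ (s″ , h′) = inj₂ (s″ , λ i →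
    ℤP.≤-trans (ℤP.≤-reflexive (trans (cong (λ t → Φ s i + t) (ℤP.+-comm 1ℤ (+ n)))
                                      (sym (ℤP.+-assoc (Φ s i) (+ n) 1ℤ))))
               (ℤP.≤-trans (ℤP.+-monoˡ-≤ 1ℤ (h i)) (h′ i)))

  eventually-positive : ∀ s → E ⊎ Σ S λ s′ → ∀ i → 1ℤ ≤ Φ s′ i
  eventually-positive s with Fin-bound (λ i → ∣ Φ s i ∣)
  ... | n , bound with climb (suc n) s
  ...   | inj₁ e = inj₁ e
  ...   | inj₂ (s′ , h) = inj₂ (s′ , λ i → ℤP.≤-trans (1≤i+suc∣i∣ (Φ s i) (bound i)) (h i))


Mat : Set
Mat = Fin 3 → Fin 3 → ℤ

Abundant : Mat → Set
Abundant B = ∀ i j → i ≢ j → 2 ℕ.≤ ∣ B i j ∣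

Fin3-cover : ∀ (m n p k : Fin 3) → m ≢ n → n ≢ p → p ≢ m → k ≡ m ⊎ k ≡ n ⊎ k ≡ p
Fin3-cover = from-yes (all? {n = 3} λ m → all? {n = 3} λ n → all? {n = 3} λ p → all? {n = 3} λ k →
  ¬? (m ≟ n) →-dec ¬? (n ≟ p) →-dec ¬? (p ≟ m) →-dec (k ≟ m ⊎-dec k ≟ n ⊎-dec k ≟ p))

mutB-jk : ∀ j (B : Mat) k → mutB j B j k ≡ - B j k
mutB-jk j B k with j ≟ j
... | yes _  = refl
... | no j≢j = ⊥-elim (j≢j refl)

mutB-ij : ∀ j (B : Mat) {i} → i ≢ j → mutB j B i j ≡ - B i j
mutB-ij j B {i} i≢j with i ≟ j | j ≟ j
... | yes i≡j | _      = ⊥-elim (i≢j i≡j)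
... | no _    | yes _  = refl
... | no _    | no j≢j = ⊥-elim (j≢j refl)

mutB-ik : ∀ j (B : Mat) {i k} → i ≢ j → k ≢ j → mutB j B i k ≡ mutEntry (B i j) (B j k) (B i k)
mutB-ik j B {i} {k} i≢j k≢j with i ≟ j | k ≟ j
... | yes i≡j | _       = ⊥-elim (i≢j i≡j)
... | no _    | yes k≡j = ⊥-elim (k≢j k≡j)
... | no _    | no _    = refl

mutC-j : ∀ {f} j (B : Mat) (C : Fin f → Fin 3 → ℤ) r → mutC j B C r j ≡ - C r j
mutC-j j B C r with j ≟ j
... | yes _  = refl
... | no j≢j = ⊥-elim (j≢j refl)

mutC-k : ∀ {f} j (B : Mat) (C : Fin f → Fin 3 → ℤ) r {k} → k ≢ j → mutC j B C r k ≡ mutEntry (C r j) (B j k) (C r k)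
mutC-k j B C r {k} k≢j with k ≟ j
... | yes k≡j = ⊥-elim (k≢j k≡j)
... | no _    = refl

mutB-skew : ∀ {B} → SkewSym B → ∀ j → SkewSym (mutB j B)
mutB-skew {B} sk j i k with i ≟ j | k ≟ j
... | yes _ | yes _ = cong -_ (sk i k)
... | yes _ | no _  = cong -_ (sk i k)
... | no _  | yes _ = cong -_ (sk i k)
... | no _  | no _  =
  trans (mutEntry-skew (B i j) (B j k) (B i k))
        (cong -_ (trans (cong₂ (λ u v → mutEntry u v (- B i k)) (sym (sk k j)) (sym (sk j i)))
                        (cong (mutEntry (B k j) (B j i)) (sym (sk k i)))))

record Arrow (B : Mat) (i j : Fin 3) : Set where
  field
    fwd : 2ℤ ≤ B i j
    bwd : B j i ≤ -2ℤ

arrow : ∀ {B} → SkewSym B → ∀ {i j} → 2ℤ ≤ B i j → Arrow B i j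
arrow sk {i} {j} w = record { fwd = w ; bwd = subst (_≤ -2ℤ) (sym (sk j i)) (ℤP.neg-mono-≤ w) }

arrow-distinct : ∀ {B i j} → Arrow B i j → i ≢ j
arrow-distinct a refl with ℤP.≤-trans (Arrow.fwd a) (Arrow.bwd a)
... | ()

record Cycle (B : Mat) (m n p : Fin 3) : Set where
  constructor mkCycle
  field
    mn : Arrow B m n
    np : Arrow B n p
    pm : Arrow B p m

record Acyclic (B : Mat) (a b c : Fin 3) : Set where
  constructor mkAcyclic
  field
    ab : Arrow B a b
    bc : Arrow B b c
    ac : Arrow B a c

rotate : ∀ {B m n p} → Cycle B m n p → Cycle B n p m
rotate (mkCycle mn np pm) = mkCycle np pm mn

cycle-cover : ∀ {B m n p} → Cycle B m n p → ∀ k → k ≡ m ⊎ k ≡ n ⊎ k ≡ p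
cycle-cover (mkCycle mn np pm) k = Fin3-cover _ _ _ k (arrow-distinct mn) (arrow-distinct np) (arrow-distinct pm)

cycle-cover′ : ∀ {B m n p} → Cycle B m n p → ∀ k → k ≡ n ⊎ k ≡ p ⊎ k ≡ m
cycle-cover′ (mkCycle mn np pm) k = Fin3-cover _ _ _ k (arrow-distinct np) (arrow-distinct pm) (arrow-distinct mn)

acyclic-cover : ∀ {B a b c} → Acyclic B a b c → ∀ k → k ≡ a ⊎ k ≡ b ⊎ k ≡ c
acyclic-cover (mkAcyclic ab bc ac) k = Fin3-cover _ _ _ k (arrow-distinct ab) (arrow-distinct bc) (arrow-distinct ac ∘ sym)

2≤⇒0< : ∀ {x} → 2ℤ ≤ x → 0ℤ < x
2≤⇒0< = ℤP.<-≤-trans (ℤ.+<+ (s≤s z≤n))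

neg-heavy : ∀ {x} → x < 0ℤ → 2 ℕ.≤ ∣ x ∣ → x ≤ -2ℤ
neg-heavy { -[1+ n ]} _ (s≤s 1≤n) = ℤ.-≤- 1≤n
neg-heavy {+ n} (ℤ.+<+ ()) _

cycle-mutate : ∀ {B m n p} → SkewSym B → Abundant (mutB n B) → CyclePreservingAt n B →
  Cycle B m n p → Cycle (mutB n B) n m p
cycle-mutate {B} {m} {n} {p} sk ab cp cyc = record
  { mn = arrow sk′ (subst (2ℤ ≤_) (sym (mutB-jk n B m)) (ℤP.neg-mono-≤ (Arrow.bwd mn)))
  ; np = record { fwd = subst (2ℤ ≤_) (sym (sk′ m p)) (ℤP.neg-mono-≤ p→m′) ; bwd = p→m′ }
  ; pm = arrow sk′ (subst (2ℤ ≤_) (sym (mutB-ij n B (p≢n))) (ℤP.neg-mono-≤ (Arrow.bwd np)))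
  }
  where
    open Cycle cyc
    sk′ : SkewSym (mutB n B)
    sk′ = mutB-skew sk n
    m≢n : m ≢ n
    m≢n = arrow-distinct mn
    p≢n : p ≢ n
    p≢n = λ p≡n → arrow-distinct np (sym p≡n)
    p≢m : p ≢ m
    p≢m = arrow-distinct pm
    -- Cycle-preservation keeps m, n, p an oriented cycle; as n → m now, it is m → p → n → m.
    p→m′ : mutB n B p m ≤ -2ℤ
    p→m′ with cp m p m≢n p≢n (λ m≡p → p≢m (sym m≡p))
                (inj₁ (2≤⇒0< (Arrow.fwd mn) , 2≤⇒0< (Arrow.fwd np) , 2≤⇒0< (Arrow.fwd pm)))
    ... | inj₁ (0<m→n′ , _ , _) = ⊥-elim (ℤP.<⇒≱ 0<m→n′ (subst (_≤ 0ℤ) (sym (mutB-ij n B m≢n))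
                                       (≤-2⇒≤0 (ℤP.neg-mono-≤ (Arrow.fwd mn)))))
    ... | inj₂ (_ , _ , p→m′<0) = neg-heavy p→m′<0 (ab p m p≢m)

acyclic-mutate-source : ∀ {B a b c} → SkewSym B → Acyclic B a b c → Acyclic (mutB a B) b c a
acyclic-mutate-source {B} {a} {b} {c} sk acyc = mkAcyclic
  (arrow sk′ (subst (2ℤ ≤_) (sym (mutB-ik a B b≢a c≢a))
               (ℤP.≤-trans (Arrow.fwd bc) (mutEntry-≥ (B b a) (B b c) (2≤⇒0≤ (Arrow.fwd ac))))))
  (arrow sk′ (subst (2ℤ ≤_) (sym (mutB-ij a B c≢a)) (ℤP.neg-mono-≤ (Arrow.bwd ac))))
  (arrow sk′ (subst (2ℤ ≤_) (sym (mutB-ij a B b≢a)) (ℤP.neg-mono-≤ (Arrow.bwd ab))))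
  where
    open Acyclic acyc
    sk′ : SkewSym (mutB a B)
    sk′ = mutB-skew sk a
    b≢a : b ≢ a
    b≢a = arrow-distinct ab ∘ sym
    c≢a : c ≢ a
    c≢a = arrow-distinct ac ∘ sym

acyclic-mutate-middle : ∀ {B a b c} → SkewSym B → Acyclic B a b c → Cycle (mutB b B) b a c
acyclic-mutate-middle {B} {a} {b} {c} sk acyc = mkCycle
  (arrow sk′ (subst (2ℤ ≤_) (sym (mutB-jk b B a)) (ℤP.neg-mono-≤ (Arrow.bwd ab))))
  (arrow sk′ (subst (2ℤ ≤_) (sym (mutB-ik b B (arrow-distinct ab) (arrow-distinct bc ∘ sym)))
               (ℤP.≤-trans (Arrow.fwd ac) (mutEntry-≥ (B a b) (B a c) (2≤⇒0≤ (Arrow.fwd bc))))))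
  (arrow sk′ (subst (2ℤ ≤_) (sym (mutB-ij b B (arrow-distinct bc ∘ sym))) (ℤP.neg-mono-≤ (Arrow.bwd bc))))
  where
    open Acyclic acyc
    sk′ : SkewSym (mutB b B)
    sk′ = mutB-skew sk b

data Shape (B : Mat) : Set where
  cyclic  : ∀ {m n p} → Cycle B m n p → Shape B
  acyclic : ∀ {a b c} → Acyclic B a b c → Shape B

heavy-sign : ∀ x → 2 ℕ.≤ ∣ x ∣ → 2ℤ ≤ x ⊎ x ≤ -2ℤ
heavy-sign (+ n)    h       = inj₁ (ℤ.+≤+ h)
heavy-sign -[1+ n ] (s≤s h) = inj₂ (ℤ.-≤- h)

orient : ∀ {B} → SkewSym B → ∀ {i j} → 2 ℕ.≤ ∣ B i j ∣ → Arrow B i j ⊎ Arrow B j i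
orient {B} sk {i} {j} h with heavy-sign (B i j) h
... | inj₁ i→j = inj₁ (arrow sk i→j)
... | inj₂ j→i = inj₂ (arrow sk (subst (2ℤ ≤_) (sym (sk j i)) (ℤP.neg-mono-≤ j→i)))

v₀ v₁ v₂ : Fin 3
v₀ = Fin.zero
v₁ = Fin.suc Fin.zero
v₂ = Fin.suc (Fin.suc Fin.zero)

classify : ∀ {B} → SkewSym B → Abundant B → Shape B
classify sk ab with orient sk (ab v₀ v₁ λ ()) | orient sk (ab v₁ v₂ λ ()) | orient sk (ab v₂ v₀ λ ())
... | inj₁ a01 | inj₁ a12 | inj₁ a20 = cyclic (mkCycle a01 a12 a20)
... | inj₂ a10 | inj₂ a21 | inj₂ a02 = cyclic (mkCycle a02 a21 a10)
... | inj₁ a01 | inj₁ a12 | inj₂ a02 = acyclic (mkAcyclic a01 a12 a02)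
... | inj₁ a01 | inj₂ a21 | inj₁ a20 = acyclic (mkAcyclic a20 a01 a21)
... | inj₂ a10 | inj₁ a12 | inj₁ a20 = acyclic (mkAcyclic a12 a20 a10)
... | inj₁ a01 | inj₂ a21 | inj₂ a02 = acyclic (mkAcyclic a02 a21 a01)
... | inj₂ a10 | inj₁ a12 | inj₂ a02 = acyclic (mkAcyclic a10 a02 a12)
... | inj₂ a10 | inj₂ a21 | inj₁ a20 = acyclic (mkAcyclic a21 a10 a20)

rowAt : (Fin 3 → ℤ) → Fin 3 → Fin 3 → Fin 3 → Row
rowAt c x y z = c x , c y , c z

module _ {f} (B : Mat) (C : Fin f → Fin 3 → ℤ) (r : Fin f) where

  mutC-mutate₁ : ∀ {x y z} → y ≢ x → z ≢ x →
    rowAt (mutC x B C r) y z x ≡ mutate₁ (B x y) (B x z) (rowAt (C r) x y z)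
  mutC-mutate₁ {x} y≢x z≢x = cong₂ _,_ (mutC-k x B C r y≢x) (cong₂ _,_ (mutC-k x B C r z≢x) (mutC-j x B C r))

  mutC-mutate₂ : ∀ {x y z} → x ≢ y → z ≢ y →
    rowAt (mutC y B C r) y x z ≡ mutate₂ (B y x) (B y z) (rowAt (C r) x y z)
  mutC-mutate₂ {y = y} x≢y z≢y = cong₂ _,_ (mutC-j y B C r) (cong₂ _,_ (mutC-k y B C r x≢y) (mutC-k y B C r z≢y))

  mutC-nonzero : ∀ j → (∃ λ k → C r k ≢ 0ℤ) → ∃ λ k → mutC j B C r k ≢ 0ℤ
  mutC-nonzero j (k , Cₖ≢0) with C r j ℤP.≟ 0ℤ
  ... | no Cⱼ≢0 = j , λ eq → Cⱼ≢0 (trans (sym (ℤP.neg-involutive (C r j)))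
                                         (cong -_ (trans (sym (mutC-j j B C r)) eq)))
  ... | yes Cⱼ≡0 = k , λ eq → Cₖ≢0 (trans (sym (mutEntry-zero (B j k) (C r k)))
                                          (trans (cong (λ t → mutEntry t (B j k) (C r k)) (sym Cⱼ≡0))
                                                 (trans (sym (mutC-k j B C r k≢j)) eq)))
    where k≢j : k ≢ j
          k≢j refl = Cₖ≢0 Cⱼ≡0

rowAt-nonzero : ∀ {c : Fin 3 → ℤ} {m n p} → m ≢ n → n ≢ p → p ≢ m →
  (∃ λ k → c k ≢ 0ℤ) → rowAt c m n p ≢ zeroRow
rowAt-nonzero {c} {m} {n} {p} m≢n n≢p p≢m (k , cₖ≢0) eq with Fin3-cover m n p k m≢n n≢p p≢m
... | inj₁ refl        = cₖ≢0 (cong proj₁ eq)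
... | inj₂ (inj₁ refl) = cₖ≢0 (cong (proj₁ ∘ proj₂) eq)
... | inj₂ (inj₂ refl) = cₖ≢0 (cong (proj₂ ∘ proj₂) eq)

EventuallySignCoherent : ∀ {f} → Quiver f → (ℕ → Fin 3) → Set
EventuallySignCoherent Q M = ∃ λ T → ∀ j → j ℕ.> T → SignCoherent (Qseq Q M j)

module Trajectory {f : ℕ} (Q : Quiver f) (M : ℕ → Fin 3) where

  Bt : ℕ → Mat
  Bt t = B (Qseq Q M t)

  Ct : ℕ → Fin f → Fin 3 → ℤ
  Ct t = C (Qseq Q M t)

  -- Frames at time u + 1, whose last mutation was at M u.
  record CycAt (u : ℕ) : Set where
    constructor cycAt
    field
      n p     : Fin 3
      isCycle : Cycle (Bt (suc u)) (M u) n p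

  record SinkAt (u : ℕ) : Set where
    constructor sinkAt
    field
      a b       : Fin 3
      isAcyclic : Acyclic (Bt (suc u)) a b (M u)

  Frame : ℕ → Set
  Frame u = CycAt u ⊎ SinkAt u

  cycRow : ∀ {u} → CycAt u → Fin f → Row
  cycRow {u} c r = rowAt (Ct (suc u) r) (M u) (CycAt.n c) (CycAt.p c)

  sinkRow : ∀ {u} → SinkAt u → Fin f → Row
  sinkRow {u} s r = rowAt (Ct (suc u) r) (SinkAt.a s) (SinkAt.b s) (M u)

  target : ∀ {u} → Move → CycAt u → Fin 3
  target succ = CycAt.n
  target pred = CycAt.p

  target-injective : ∀ {u} (c : CycAt u) {μ ν} → target μ c ≡ target ν c → μ ≡ ν
  target-injective c {succ} {succ} _   = refl
  target-injective c {succ} {pred} n≡p = ⊥-elim (arrow-distinct (Cycle.np (CycAt.isCycle c)) n≡p)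
  target-injective c {pred} {succ} p≡n = ⊥-elim (arrow-distinct (Cycle.np (CycAt.isCycle c)) (sym p≡n))
  target-injective c {pred} {pred} _   = refl

  module Run (r₀ : Fin f) (red : Reduced M) (wb : WeaklyBalanced M) (sk₀ : SkewSym (B Q))
             (abundant : ∀ t → Abundant (Bt t)) (cp : ∀ t → CyclePreservingAt (M t) (Bt t))
             (nz₀ : ∀ r → ∃ λ k → C Q r k ≢ 0ℤ) where

    skew : ∀ t → SkewSym (Bt t)
    skew zero    = sk₀
    skew (suc t) = mutB-skew (skew t) (M t)

    rows-nonzero : ∀ t r → ∃ λ k → Ct t r k ≢ 0ℤ
    rows-nonzero zero    r = nz₀ r
    rows-nonzero (suc t) r = mutC-nonzero (Bt t) (Ct t) r (M t) (rows-nonzero t r)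

    next≢last : ∀ u → M (suc u) ≢ M u
    next≢last u eq = red u (sym eq)

    record CycNext {u} (c : CycAt u) : Set where
      field
        move  : Move
        next  : CycAt (suc u)
        hits  : M (suc u) ≡ target move c
        keeps : ∀ {μ} → μ ≢ move → target μ next ≡ target μ c
        steps : ∀ r → CycStep move (cycRow c r) (cycRow next r)

    cycNext : ∀ {u} (c : CycAt u) → CycNext c
    cycNext {u} (cycAt n p cyc) with cycle-cover cyc (M (suc u))
    ... | inj₁ eq = ⊥-elim (next≢last u eq)
    ... | inj₂ (inj₁ refl) = record
      { move  = succ
      ; next  = cycAt (M u) p (cycle-mutate (skew (suc u)) (abundant (suc (suc u))) (cp (suc u)) cyc)
      ; hits  = refl
      ; keeps = λ { {succ} ne → ⊥-elim (ne refl) ; {pred} _ → refl }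
      ; steps = λ r → subst (CycStep succ _) (sym (mutC-mutate₂ (Bt (suc u)) (Ct (suc u)) r {M u} {M (suc u)} {p}
                        (arrow-distinct mn) (arrow-distinct np ∘ sym)))
                        (succ-step _ (Arrow.bwd mn) (Arrow.fwd np))
      }
      where open Cycle cyc
    ... | inj₂ (inj₂ refl) = record
      { move  = pred
      ; next  = cycAt n (M u) (cycle-mutate (skew (suc u)) (abundant (suc (suc u))) (cp (suc u)) (rotate cyc))
      ; hits  = refl
      ; keeps = λ { {succ} _ → refl ; {pred} ne → ⊥-elim (ne refl) }
      ; steps = λ r → subst (CycStep pred _) (sym (mutC-mutate₂ (Bt (suc u)) (Ct (suc u)) r {n} {M (suc u)} {M u}
                        (arrow-distinct np) (arrow-distinct pm ∘ sym)))
                        (pred-step _ (Arrow.bwd np) (Arrow.fwd pm))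
      }
      where open Cycle cyc

    data SinkNext {u} (s : SinkAt u) : Set where
      source-next : (s′ : SinkAt (suc u)) → (∀ r → SourceStep (sinkRow s r) (sinkRow s′ r)) → SinkNext s
      middle-next : (c′ : CycAt (suc u)) → (∀ r → CycStep succ (sinkRow s r) (cycRow c′ r)) → SinkNext s

    sinkNext : ∀ {u} (s : SinkAt u) → SinkNext s
    sinkNext {u} (sinkAt a b acyc) with acyclic-cover acyc (M (suc u))
    ... | inj₁ refl = source-next (sinkAt b (M u) (acyclic-mutate-source (skew (suc u)) acyc))
      (λ r → subst (SourceStep _) (sym (mutC-mutate₁ (Bt (suc u)) (Ct (suc u)) r {M (suc u)} {b} {M u}
               (arrow-distinct ab ∘ sym) (arrow-distinct ac ∘ sym)))
               (source-step _ (Arrow.fwd ab) (Arrow.fwd ac)))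
      where open Acyclic acyc
    ... | inj₂ (inj₁ refl) = middle-next (cycAt a (M u) (acyclic-mutate-middle (skew (suc u)) acyc))
      (λ r → subst (CycStep succ _) (sym (mutC-mutate₂ (Bt (suc u)) (Ct (suc u)) r {a} {M (suc u)} {M u}
               (arrow-distinct ab) (arrow-distinct bc ∘ sym)))
               (succ-step _ (Arrow.bwd ab) (Arrow.fwd bc)))
      where open Acyclic acyc
    ... | inj₂ (inj₂ eq) = ⊥-elim (next≢last u eq)

    data Inv (u : ℕ) : Set where
      acyc-inv  : (s : SinkAt u) → (∀ r → AcycGood (sinkRow s r)) → Inv u
      entry-inv : (c : CycAt u) → (∀ r → CycEntry (cycRow c r)) → Inv u
      good-inv  : (c : CycAt u) → (∀ r → CycGood (cycRow c r)) → Inv u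

    acyc-next : ∀ {u} (s : SinkAt u) → (∀ r → AcycGood (sinkRow s r)) → SinkNext s → Inv (suc u)
    acyc-next s good (source-next s′ st) = acyc-inv s′ (λ r → acycGood-step (st r) (proj₁ (good r)))
    acyc-next s good (middle-next c′ st) = entry-inv c′ (λ r → acycGood-middle (st r) (good r))

    entry-next : ∀ {u} (c : CycAt u) → (∀ r → CycEntry (cycRow c r)) → CycNext c → Inv (suc u)
    entry-next c entry record { move = succ ; next = c′ ; steps = st } =
      good-inv c′ (λ r → cycEntry-succ (st r) (entry r))
    entry-next c entry record { move = pred ; next = c′ ; steps = st } =
      entry-inv c′ (λ r → cycEntry-pred (st r) (entry r))

    good-next : ∀ {u} (c : CycAt u) → (∀ r → CycGood (cycRow c r)) → CycNext c → Inv (suc u)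
    good-next c good record { next = c′ ; steps = st } = good-inv c′ (λ r → cycGood-step (st r) (good r))

    inv-step : ∀ {u} → Inv u → Inv (suc u)
    inv-step (acyc-inv s good)   = acyc-next s good (sinkNext s)
    inv-step (entry-inv c entry) = entry-next c entry (cycNext c)
    inv-step (good-inv c good)   = good-next c good (cycNext c)

    invariant-from : ∀ {U} → Inv U → ∀ d → Inv (d ℕ.+ U)
    invariant-from inv zero    = inv
    invariant-from inv (suc d) = inv-step (invariant-from inv d)

    StrictSign : ℕ → Fin 3 → Set
    StrictSign t v = (∀ r → 1ℤ ≤ Ct t r v) ⊎ (∀ r → Ct t r v ≤ -1ℤ)

    pick-sign : ∀ {u x y v} → v ≢ M u → v ≡ x ⊎ v ≡ y ⊎ v ≡ M u →
                StrictSign (suc u) x → StrictSign (suc u) y → StrictSign (suc u) v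
    pick-sign _   (inj₁ refl)        sx _  = sx
    pick-sign _   (inj₂ (inj₁ refl)) _  sy = sy
    pick-sign v≢m (inj₂ (inj₂ refl)) _  _  = ⊥-elim (v≢m refl)

    inv-signs : ∀ {u} → Inv u → ∀ v → v ≢ M u → StrictSign (suc u) v
    inv-signs (acyc-inv (sinkAt a b acyc) good) v v≢m =
      pick-sign v≢m (acyclic-cover acyc v)
        (inj₁ λ r → proj₁ (proj₂ (good r))) (inj₁ λ r → proj₁ (proj₂ (proj₂ (good r))))
    inv-signs {u} (entry-inv (cycAt n p cyc) entry) v v≢m =
      pick-sign v≢m (cycle-cover′ cyc v)
        (inj₁ λ r → proj₁ (cycEntry-signs {Ct (suc u) r (M u)} {Ct (suc u) r n} {Ct (suc u) r p} (entry r)))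
        (inj₁ λ r → proj₂ (cycEntry-signs {Ct (suc u) r (M u)} {Ct (suc u) r n} {Ct (suc u) r p} (entry r)))
    inv-signs {u} (good-inv (cycAt n p cyc) good) v v≢m =
      pick-sign v≢m (cycle-cover′ cyc v)
        (inj₂ λ r → proj₁ (cycGood-signs {Ct (suc u) r (M u)} {Ct (suc u) r n} {Ct (suc u) r p} (good r)))
        (inj₁ λ r → proj₂ (cycGood-signs {Ct (suc u) r (M u)} {Ct (suc u) r n} {Ct (suc u) r p} (good r)))

    flip-sign : ∀ u → StrictSign (suc u) (M (suc u)) → StrictSign (suc (suc u)) (M (suc u))
    flip-sign u (inj₁ pos) = inj₂ λ r → subst (_≤ -1ℤ) (sym (mutC-j (M (suc u)) (Bt (suc u)) (Ct (suc u)) r))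
                                                 (ℤP.neg-mono-≤ (pos r))
    flip-sign u (inj₂ neg) = inj₁ λ r → subst (1ℤ ≤_) (sym (mutC-j (M (suc u)) (Bt (suc u)) (Ct (suc u)) r))
                                                 (ℤP.neg-mono-≤ (neg r))

    red-or-green : ∀ t v → StrictSign t v → Red (Qseq Q M t) v ⊎ Green (Qseq Q M t) v
    red-or-green t v (inj₁ pos) = inj₁ ((r₀ , 1≤⇒≢0 (pos r₀)) , λ r → 1≤⇒0≤ (pos r))
    red-or-green t v (inj₂ neg) = inj₂ ((r₀ , ≤-1⇒≢0 (neg r₀)) , λ r → ≤-1⇒≤0 (neg r))

    signs-after : ∀ {u} → Inv u → Inv (suc u) → ∀ v → Dec (v ≡ M (suc u)) → StrictSign (suc (suc u)) v
    signs-after     inv₀ inv₁ v (no v≢)   = inv-signs inv₁ v v≢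
    signs-after {u} inv₀ inv₁ v (yes refl) = flip-sign u (inv-signs inv₀ (M (suc u)) (next≢last u))

    coherent : ∀ {u} → Inv u → Inv (suc u) → SignCoherent (Qseq Q M (suc (suc u)))
    coherent {u} inv₀ inv₁ v = red-or-green (suc (suc u)) v (signs-after inv₀ inv₁ v (v ≟ M (suc u)))

    cycRow-nonzero : ∀ {u} (c : CycAt u) r → cycRow c r ≢ zeroRow
    cycRow-nonzero {u} (cycAt n p (mkCycle mn np pm)) r =
      rowAt-nonzero (arrow-distinct mn) (arrow-distinct np) (arrow-distinct pm) (rows-nonzero (suc u) r)

    sinkRow-nonzero : ∀ {u} (s : SinkAt u) r → sinkRow s r ≢ zeroRow
    sinkRow-nonzero {u} (sinkAt a b (mkAcyclic ab bc ac)) r =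
      rowAt-nonzero (arrow-distinct ab) (arrow-distinct bc) (arrow-distinct ac ∘ sym) (rows-nonzero (suc u) r)

    module FromCycle {u₀} (c₀ : CycAt u₀) where

      frame : ∀ i → CycAt (i ℕ.+ u₀)
      frame zero    = c₀
      frame (suc i) = CycNext.next (cycNext (frame i))

      kind : ℕ → Move
      kind i = CycNext.move (cycNext (frame i))

      open CyclicRun kind

      ahead : ∀ μ d N → M (suc (d ℕ.+ N ℕ.+ u₀)) ≡ target μ (frame N) → ∃ λ d′ → kind (d′ ℕ.+ N) ≡ μ
      ahead μ zero N hit = 0 , target-injective (frame N) (trans (sym (CycNext.hits (cycNext (frame N)))) hit)
      ahead μ (suc d) N hit = decide (kind N ≟ₘ μ)
        where
          decide : Dec (kind N ≡ μ) → ∃ λ d′ → kind (d′ ℕ.+ N) ≡ μ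
          decide (yes kₙ≡μ) = 0 , kₙ≡μ
          decide (no kₙ≢μ) =
            suc (proj₁ later) , subst (λ t → kind t ≡ μ) (ℕP.+-suc (proj₁ later) N) (proj₂ later)
            where
              later : ∃ λ d′ → kind (d′ ℕ.+ suc N) ≡ μ
              later = ahead μ d (suc N) (trans (cong (λ t → M (suc (t ℕ.+ u₀))) (ℕP.+-suc d N))
                                          (trans hit (sym (CycNext.keeps (cycNext (frame N)) (kₙ≢μ ∘ sym)))))

      infinitely-often : ∀ μ → InfinitelyOften μ
      infinitely-often μ N = hit-ahead (wb (target μ (frame N)) (suc (N ℕ.+ u₀)))
        where
          hit-ahead : (∃ λ t → t ℕ.≥ suc (N ℕ.+ u₀) × M t ≡ target μ (frame N)) → ∃ λ d → kind (d ℕ.+ N) ≡ μ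
          hit-ahead (t , t> , Mₜ) = ahead μ d N (trans (cong M t≡) Mₜ)
            where
              d : ℕ
              d = t ∸ suc (N ℕ.+ u₀)
              t≡ : suc (d ℕ.+ N ℕ.+ u₀) ≡ t
              t≡ = begin
                suc (d ℕ.+ N ℕ.+ u₀)   ≡⟨ cong suc (ℕP.+-assoc d N u₀) ⟩
                suc (d ℕ.+ (N ℕ.+ u₀)) ≡⟨ sym (ℕP.+-suc d (N ℕ.+ u₀)) ⟩
                d ℕ.+ suc (N ℕ.+ u₀)   ≡⟨ ℕP.m∸n+n≡m t> ⟩
                t                      ∎
                where open ≡-Reasoning

      row : Fin f → ℕ → Row
      row r i = cycRow (frame i) r

      rowStep : ∀ r i → CycStep (kind i) (row r i) (row r (suc i))
      rowStep r i = CycNext.steps (cycNext (frame i)) r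

      rise : ∀ N → ⊥ ⊎ Σ ℕ λ N′ → ∀ r → cycPotential (row r N) + 1ℤ ≤ cycPotential (row r N′)
      rise N = inj₂ (rise-over (window-after (infinitely-often succ) (infinitely-often pred) N))
        where
          rise-over : (∃₂ λ q k → N ℕ.≤ q × Window q k) →
                      Σ ℕ λ N′ → ∀ r → cycPotential (row r N) + 1ℤ ≤ cycPotential (row r N′)
          rise-over (q , k , N≤q , w) =
            suc (suc k) ℕ.+ q , λ r → ℤP.≤-trans (ℤP.+-monoˡ-≤ 1ℤ (up-to-q r)) (across r)
            where
              up-to-q : ∀ r → cycPotential (row r N) ≤ cycPotential (row r q)
              up-to-q r = subst (λ t → cycPotential (row r N) ≤ cycPotential (row r t)) (ℕP.m∸n+n≡m N≤q)
                                (Along.potential-mono (row r) (rowStep r) (q ∸ N) N)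
              nonzero : ∀ r → row r q ≢ zeroRow
              nonzero r = cycRow-nonzero (frame q) r
              across : ∀ r → cycPotential (row r q) + 1ℤ ≤ cycPotential (row r (suc (suc k) ℕ.+ q))
              across r = Along.window-rise (row r) (rowStep r) {q} {k} w (nonzero r)

      result : Σ ℕ Inv
      result = from-climb (Climb.eventually-positive (λ i r → cycPotential (row r i)) rise 0)
        where
          from-climb : ⊥ ⊎ (Σ ℕ λ T → ∀ r → 1ℤ ≤ cycPotential (row r T)) → Σ ℕ Inv
          from-climb (inj₂ (T , good)) = T ℕ.+ u₀ , good-inv (frame T) good

    module FromSink {u₀} (s₀ : SinkAt u₀) where

      State : Set
      State = Σ ℕ SinkAt

      Φ : State → Fin f → ℤ
      Φ (_ , s) r = acycPotential (sinkRow s r)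

      rise : ∀ us → Σ ℕ CycAt ⊎ Σ State λ us′ → ∀ r → Φ us r + 1ℤ ≤ Φ us′ r
      rise (u , s) = first (sinkNext s)
        where
          third : ∀ (s₁ : SinkAt (suc u)) (s₂ : SinkAt (suc (suc u))) →
                  (∀ r → SourceStep (sinkRow s r) (sinkRow s₁ r)) → (∀ r → SourceStep (sinkRow s₁ r) (sinkRow s₂ r)) →
                  SinkNext s₂ → Σ ℕ CycAt ⊎ Σ State λ us′ → ∀ r → Φ (u , s) r + 1ℤ ≤ Φ us′ r
          third _ _ st₁ st₂ (source-next s₃ st₃) =
            inj₂ ((_ , s₃) , λ r → three-steps-rise (st₁ r) (st₂ r) (st₃ r) (sinkRow-nonzero s r))
          third _ _ _   _   (middle-next c _)    = inj₁ (_ , c)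
          second : ∀ (s₁ : SinkAt (suc u)) → (∀ r → SourceStep (sinkRow s r) (sinkRow s₁ r)) →
                   SinkNext s₁ → Σ ℕ CycAt ⊎ Σ State λ us′ → ∀ r → Φ (u , s) r + 1ℤ ≤ Φ us′ r
          second s₁ st₁ (source-next s₂ st₂) = third s₁ s₂ st₁ st₂ (sinkNext s₂)
          second _ _   (middle-next c _)    = inj₁ (_ , c)
          first : SinkNext s → Σ ℕ CycAt ⊎ Σ State λ us′ → ∀ r → Φ (u , s) r + 1ℤ ≤ Φ us′ r
          first (source-next s₁ st₁) = second s₁ st₁ (sinkNext s₁)
          first (middle-next c _)    = inj₁ (_ , c)

      result : Σ ℕ Inv
      result = from-climb (Climb.eventually-positive Φ rise (u₀ , s₀))
        where
          settle : ∀ {u} (s : SinkAt u) → (∀ r → 1ℤ ≤ acycPotential (sinkRow s r)) → SinkNext s → Σ ℕ Inv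
          settle {u} _ pos (source-next s′ st) = suc u , acyc-inv s′ (λ r → acycGood-step (st r) (pos r))
          settle     _ _   (middle-next c _)   = FromCycle.result c
          from-climb : Σ ℕ CycAt ⊎ (Σ State λ us → ∀ r → 1ℤ ≤ Φ us r) → Σ ℕ Inv
          from-climb (inj₁ (_ , c))         = FromCycle.result c
          from-climb (inj₂ ((_ , s) , pos)) = settle s pos (sinkNext s)

    eventual-invariant : ∀ {u} → Frame u → Σ ℕ Inv
    eventual-invariant (inj₁ c) = FromCycle.result c
    eventual-invariant (inj₂ s) = FromSink.result s

    eventually-coherent : ∀ {u} → Frame u → EventuallySignCoherent Q M
    eventually-coherent fr = from (eventual-invariant fr)
      where
        from : Σ ℕ Inv → EventuallySignCoherent Q M
        from (U , inv) = suc U , coherent-after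
          where
            inv-at : ∀ u → U ℕ.≤ u → Inv u
            inv-at u U≤u = subst Inv (ℕP.m∸n+n≡m U≤u) (invariant-from inv (u ∸ U))
            coherent-after : ∀ j → j ℕ.> suc U → SignCoherent (Qseq Q M j)
            coherent-after (suc (suc u)) (s≤s (s≤s U≤u)) =
              coherent (inv-at u U≤u) (inv-at (suc u) (ℕP.m≤n⇒m≤1+n U≤u))

-- The opposite quiver

negMat : Mat → Mat
negMat B i k = - B i k

opQuiver : ∀ {f} → Quiver f → Quiver f
opQuiver Q = quiver (negMat (B Q)) (λ r k → - C Q r k)

skew-neg : ∀ {B} → SkewSym B → SkewSym (negMat B)
skew-neg sk i k = cong -_ (sk i k)

Negation : Mat → Mat → Set
Negation B B′ = ∀ i k → B′ i k ≡ - B i k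

negation-sym : ∀ {B B′} → Negation B B′ → Negation B′ B
negation-sym {B} {B′} e i k = trans (sym (ℤP.neg-involutive (B i k))) (cong -_ (sym (e i k)))

mutB-neg : ∀ j {B B′} → Negation B B′ → Negation (mutB j B) (mutB j B′)
mutB-neg j {B} {B′} e i k with i ≟ j | k ≟ j
... | yes _ | _     = cong -_ (e i k)
... | no _  | yes _ = cong -_ (e i k)
... | no _  | no _  = trans (cong₂ (λ x y → mutEntry x y (B′ i k)) (e i j) (e j k))
                           (trans (cong (mutEntry (- B i j) (- B j k)) (e i k)) (mutEntry-neg (B i j) (B j k) (B i k)))

mutC-neg : ∀ {f} j {B B′} {Cs Cs′ : Fin f → Fin 3 → ℤ} → Negation B B′ → (∀ r k → Cs′ r k ≡ - Cs r k) →
  ∀ r k → mutC j B′ Cs′ r k ≡ - mutC j B Cs r k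
mutC-neg j {B} {B′} {Cs} {Cs′} e eC r k with k ≟ j
... | yes _ = cong -_ (eC r k)
... | no _  = trans (cong₂ (λ x y → mutEntry x y (Cs′ r k)) (eC r j) (e j k))
                    (trans (cong (mutEntry (- Cs r j) (- B j k)) (eC r k)) (mutEntry-neg (Cs r j) (B j k) (Cs r k)))

Qseq-opQuiver : ∀ {f} (Q : Quiver f) M t →
  Negation (B (Qseq Q M t)) (B (Qseq (opQuiver Q) M t)) ×
  (∀ r k → C (Qseq (opQuiver Q) M t) r k ≡ - C (Qseq Q M t) r k)
Qseq-opQuiver Q M zero    = (λ _ _ → refl) , (λ _ _ → refl)
Qseq-opQuiver Q M (suc t) =
  mutB-neg (M t) (proj₁ (Qseq-opQuiver Q M t)) ,
  mutC-neg (M t) (proj₁ (Qseq-opQuiver Q M t)) (proj₂ (Qseq-opQuiver Q M t))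

abundant-neg : ∀ {B B′} → Negation B B′ → Abundant B → Abundant B′
abundant-neg {B} e ab i j i≢j =
  subst (2 ℕ.≤_) (sym (trans (cong ∣_∣ (e i j)) (ℤP.∣-i∣≡∣i∣ (B i j)))) (ab i j i≢j)

Cyclic3-neg : ∀ {B B′} → Negation B B′ → ∀ {i j k} → Cyclic3 B i j k → Cyclic3 B′ i j k
Cyclic3-neg {B} e {i} {j} {k} (inj₁ (a , b , c)) = inj₂ (flip (e i j) a , flip (e j k) b , flip (e k i) c)
  where flip : ∀ {x y} → y ≡ - x → 0ℤ < x → y < 0ℤ
        flip refl = ℤP.neg-mono-<
Cyclic3-neg {B} e {i} {j} {k} (inj₂ (a , b , c)) = inj₁ (flip (e i j) a , flip (e j k) b , flip (e k i) c)
  where flip : ∀ {x y} → y ≡ - x → x < 0ℤ → 0ℤ < y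
        flip refl = ℤP.neg-mono-<

cyclePreserving-neg : ∀ {B B′ j} → Negation B B′ → CyclePreservingAt j B → CyclePreservingAt j B′
cyclePreserving-neg {j = j} e cp i k i≢j k≢j i≢k cyc′ =
  Cyclic3-neg (mutB-neg j e) {i} {j} {k} (cp i k i≢j k≢j i≢k (Cyclic3-neg (negation-sym e) {i} {j} {k} cyc′))

module _ {f} {Q Q′ : Quiver f} (eC : ∀ r k → C Q′ r k ≡ - C Q r k) where

  nonzero-neg : ∀ {i} → (∃ λ a → C Q′ a i ≢ 0ℤ) → ∃ λ a → C Q a i ≢ 0ℤ
  nonzero-neg {i} (a , ≢0) = a , λ z → ≢0 (trans (eC a i) (cong -_ z))

  red⇒green : ∀ {i} → Red Q′ i → Green Q i
  red⇒green {i} (adj , 0≤) = nonzero-neg adj , λ r → ℤP.neg-cancel-≤ (subst (0ℤ ≤_) (eC r i) (0≤ r))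

  green⇒red : ∀ {i} → Green Q′ i → Red Q i
  green⇒red {i} (adj , ≤0) = nonzero-neg adj , λ r → ℤP.neg-cancel-≤ (subst (_≤ 0ℤ) (eC r i) (≤0 r))

  signCoherent-neg : SignCoherent Q′ → SignCoherent Q
  signCoherent-neg coh i = [ inj₂ ∘ red⇒green , inj₁ ∘ green⇒red ]′ (coh i)

arrow-op : ∀ {B i j} → Arrow B i j → Arrow (negMat B) j i
arrow-op a = record { fwd = ℤP.neg-mono-≤ (Arrow.bwd a) ; bwd = ℤP.neg-mono-≤ (Arrow.fwd a) }

acyclic-op : ∀ {B a b c} → Acyclic B a b c → Acyclic (negMat B) c b a
acyclic-op (mkAcyclic ab bc ac) = mkAcyclic (arrow-op bc) (arrow-op ab) (arrow-op ac)

module _ {f} (Q : Quiver f) (M : ℕ → Fin 3) (sk : SkewSym (B Q))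
         (ab₁ : Abundant (mutB (M 0) (B Q))) (cp₀ : CyclePreservingAt (M 0) (B Q)) where
  private
    module T  = Trajectory Q M
    module T′ = Trajectory (opQuiver Q) M

  cycle-start : ∀ {m n p} → Cycle (B Q) m n p → M 0 ≡ m ⊎ M 0 ≡ n ⊎ M 0 ≡ p → T.CycAt 0
  cycle-start {m} {n} {p} cyc (inj₁ refl)        = T.cycAt p n (cycle-mutate sk ab₁ cp₀ (rotate (rotate cyc)))
  cycle-start {m} {n} {p} cyc (inj₂ (inj₁ refl)) = T.cycAt m p (cycle-mutate sk ab₁ cp₀ cyc)
  cycle-start {m} {n} {p} cyc (inj₂ (inj₂ refl)) = T.cycAt n m (cycle-mutate sk ab₁ cp₀ (rotate cyc))

  acyclic-start : ∀ {a b c} → Acyclic (B Q) a b c → M 0 ≡ a ⊎ M 0 ≡ b ⊎ M 0 ≡ c → T.Frame 0 ⊎ T′.Frame 0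
  acyclic-start {a} {b} {c} acyc (inj₁ refl)        = inj₁ (inj₂ (T.sinkAt b c (acyclic-mutate-source sk acyc)))
  acyclic-start {a} {b} {c} acyc (inj₂ (inj₁ refl)) = inj₁ (inj₁ (T.cycAt a c (acyclic-mutate-middle sk acyc)))
  -- Mutating first at the sink c of Q is mutating first at the source c of the opposite quiver.
  acyclic-start {a} {b} {c} acyc (inj₂ (inj₂ refl)) =
    inj₂ (inj₂ (T′.sinkAt b a (acyclic-mutate-source (skew-neg sk) (acyclic-op acyc))))

  first-frame : Shape (B Q) → T.Frame 0 ⊎ T′.Frame 0
  first-frame (cyclic cyc)   = inj₁ (inj₁ (cycle-start cyc (cycle-cover cyc (M 0))))
  first-frame (acyclic acyc) = acyclic-start acyc (acyclic-cover acyc (M 0))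

mutationAbundant-along : ∀ {f} (Q : Quiver f) M → MutationAbundant (B Q) → ∀ t → MutationAbundant (B (Qseq Q M t))
mutationAbundant-along Q M ab zero       = ab
mutationAbundant-along Q M ab (suc t) js = mutationAbundant-along Q M ab t (M t ∷ js)

-- `CyclePreserving` is stated about a sequence F local to its definition; applied to a proof
-- of it, this lemma recovers F by unification and identifies it with the mutation sequence.
cyclePreserving-along : ∀ {f} (Q : Quiver f) M {F : ℕ → Mat} → (∀ ℓ → CyclePreservingAt (M ℓ) (F ℓ)) →
  F 0 ≡ B Q → (∀ ℓ → F (suc ℓ) ≡ mutB (M ℓ) (F ℓ)) → ∀ t → CyclePreservingAt (M t) (B (Qseq Q M t))
cyclePreserving-along Q M {F} cp F₀ F₊ t = subst (CyclePreservingAt (M t)) (same-sequence t) (cp t)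
  where
    same-sequence : ∀ ℓ → F ℓ ≡ B (Qseq Q M ℓ)
    same-sequence zero    = F₀
    same-sequence (suc ℓ) = trans (F₊ ℓ) (cong (mutB (M ℓ)) (same-sequence ℓ))

theorem6p3 : ∀ {f} → f ≥ 1 → (Q : Quiver f) → SkewSym (B Q) → Connected Q → MutationAbundant (B Q) →
    (M : ℕ → Fin 3) → Reduced M → WeaklyBalanced M → CyclePreserving M (B Q) →
    ∃ λ T → ∀ j → j > T → SignCoherent (Qseq Q M j)
theorem6p3 {suc _} _ Q sk (_ , adjacent) ma M red wb cp =
  [ Trajectory.Run.eventually-coherent Q M Fin.zero red wb sk abₜ cpₜ adjacent
  , op-coherent ∘ Trajectory.Run.eventually-coherent (opQuiver Q) M Fin.zero red wb (skew-neg sk) abₜ′ cpₜ′ adjacent′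
  ]′ (first-frame Q M sk (abₜ 1) (cpₜ 0) (classify sk (abₜ 0)))
  where
    abₜ : ∀ t → Abundant (B (Qseq Q M t))
    abₜ t = mutationAbundant-along Q M ma t []
    cpₜ : ∀ t → CyclePreservingAt (M t) (B (Qseq Q M t))
    cpₜ = cyclePreserving-along Q M cp refl (λ _ → refl)
    abₜ′ : ∀ t → Abundant (B (Qseq (opQuiver Q) M t))
    abₜ′ t = abundant-neg (proj₁ (Qseq-opQuiver Q M t)) (abₜ t)
    cpₜ′ : ∀ t → CyclePreservingAt (M t) (B (Qseq (opQuiver Q) M t))
    cpₜ′ t = cyclePreserving-neg (proj₁ (Qseq-opQuiver Q M t)) (cpₜ t)
    adjacent′ : ∀ r → ∃ λ k → C (opQuiver Q) r k ≢ 0ℤ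
    adjacent′ r = proj₁ (adjacent r) , λ z → proj₂ (adjacent r) (trans (sym (ℤP.neg-involutive _)) (cong -_ z))
    op-coherent : EventuallySignCoherent (opQuiver Q) M → EventuallySignCoherent Q M
    op-coherent (T , coh) = T , λ j j>T →
      signCoherent-neg {Q = Qseq Q M j} {Qseq (opQuiver Q) M j} (proj₂ (Qseq-opQuiver Q M j)) (coh j j>T)
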